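{- Let $p>0$, $n\geq 4p$ and $\gamma>0$ be integers. Suppose there exists an integer $\alpha$ with $2p-1\leq \alpha\leq n-1-2p$ and $\gcd(n,\alpha)=1$. Then there exists a globally simple support shifted Heffter array $H(n;4p,\gamma)$ whose non-empty cells are precisely the cells of the diagonals $D_i$ for $i\in\{0,1,\dots,4p-2\}\cup\{2p+\alpha\}$.
   Context: Rows and columns of an $n\times n$ array are indexed by $0,1,\dots,n-1$, with indices computed modulo $n$. For $d\in\{0,\dots,n-1\}$ the diagonal $D_d$ is the set of cells $\{(i+d \bmod n,\ i) : i=0,\dots,n-1\}$, where $(r,c)$ denotes row $r$, column $c$. The support of an array is the set of absolute values of its entries. A support shifted Heffter array $H(n;4p,\gamma)$ is an $n\times n$ array $A$ of integers (some cells empty) such that: (P1) every row and every column of $A$ has exactly $4p$ filled cells; (P2) the support of $A$ is $\{\gamma n+1,\dots,(4p+\gamma)n\}$; (P3) the entries in every row and every column sum to $0$ (in $\mathbb{Z}$). It is globally simple if moreover, for every row (entries read from left to right, i.e. increasing column index) and every column (entries read from top to bottom, i.e. increasing row index), writing its entries in this order as $a_0,\dots,a_{4p-1}$, the partial sums $\sum_{j=0}^{i}a_j$, $i=0,\dots,4p-1$, are pairwise distinct modulo $2(4p+\gamma)n+1$. -}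

module Defs where

open import Data.Nat using (ℕ; _+_; _*_; _∸_; _≤_; _<_)
open import Data.Integer as ℤ using (ℤ; +_; ∣_∣) renaming (_+_ to _+ℤ_; _-_ to _-ℤ_)
open import Data.Integer.Divisibility using (_∣_)
open import Data.Fin using (Fin; toℕ)
open import Data.List using (List; []; _∷_; map; foldr; mapMaybe; allFin; length)
open import Data.List.Relation.Unary.AllPairs using (AllPairs)
open import Data.Maybe using (Maybe; just)
open import Data.Product using (Σ; ∃; _×_; _,_)
open import Data.Sum using (_⊎_)
open import Relation.Binary.PropositionalEquality using (_≡_)
open import Relation.Nullary using (¬_)

Array : ℕ → Set
Array n = Fin n → Fin n → Maybe ℤ

rowEntries : ∀ {n} → Array n → Fin n → List ℤ
rowEntries {n} A r = mapMaybe (λ c → A r c) (allFin n)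

colEntries : ∀ {n} → Array n → Fin n → List ℤ
colEntries {n} A c = mapMaybe (λ r → A r c) (allFin n)

sumℤ : List ℤ → ℤ
sumℤ = foldr _+ℤ_ (+ 0)

partialSums : List ℤ → List ℤ
partialSums [] = []
partialSums (x ∷ xs) = x ∷ map (x +ℤ_) (partialSums xs)

Filled : ∀ {n} → Array n → Fin n → Fin n → Set
Filled A r c = ∃ λ x → A r c ≡ just x

-- cell (r,c) lies on diagonal D_d, i.e. r ≡ c + d (mod n); meaningful for d < n
InDiag : (n d : ℕ) → Fin n → Fin n → Set
InDiag n d r c = (toℕ r ≡ toℕ c + d) ⊎ (toℕ r + n ≡ toℕ c + d)

record IsSSHeffter (n p γ : ℕ) (A : Array n) : Set where
  field
    P1-rows : ∀ r → length (rowEntries A r) ≡ 4 * p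
    P1-cols : ∀ c → length (colEntries A c) ≡ 4 * p
    P2-sub  : ∀ r c x → A r c ≡ just x →
                (γ * n + 1 ≤ ∣ x ∣) × (∣ x ∣ ≤ (4 * p + γ) * n)
    P2-sup  : ∀ k → γ * n + 1 ≤ k → k ≤ (4 * p + γ) * n →
                Σ (Fin n) λ r → Σ (Fin n) λ c → Σ ℤ λ x → (A r c ≡ just x) × (∣ x ∣ ≡ k)
    P3-rows : ∀ r → sumℤ (rowEntries A r) ≡ + 0
    P3-cols : ∀ c → sumℤ (colEntries A c) ≡ + 0

DistinctMod : ℕ → List ℤ → Set
DistinctMod m = AllPairs (λ x y → ¬ ((+ m) ∣ (x -ℤ y)))

record IsGloballySimple (n p γ : ℕ) (A : Array n) : Set where
  field
    rows : ∀ r → DistinctMod (2 * (4 * p + γ) * n + 1) (partialSums (rowEntries A r))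
    cols : ∀ c → DistinctMod (2 * (4 * p + γ) * n + 1) (partialSums (colEntries A c))

module Submission where

-- Fill the diagonals D_0, …, D_{4p-2} and D_{2p+α}, each with one block of n consecutive
-- support values (γ+b)n + h, h = 1, …, n, so that the 4p blocks tile the support. Read along a row or a
-- column, the entries become a sequence w indexed by the diagonal, and the signs are chosen so that the
-- two blocks on D_{2k}, D_{2k+1} (and on D_{2p+2j+1}, D_{2p+2j+2}) nearly cancel. The column index on
-- D_{2p} and D_{2p+α} is scaled by α⁻¹ modulo n; since the two cells of a row on these diagonals are α
-- columns apart, their low-order parts then differ by exactly 1, which makes the row sums vanish as the
-- column sums do. The partial sums of a line are differences of the prefix sums of w; at the filled
-- diagonals these take pairwise distinct values (explicitly ordered) in an interval of width less than
-- 2(4p+γ)n+1, so the partial sums are pairwise distinct modulo 2(4p+γ)n+1.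

open import Data.Nat as ℕ using (ℕ; NonZero; suc)
open import Data.Nat.DivMod using (_%_)
open import Data.Integer using (ℤ)
open import Relation.Binary.PropositionalEquality using (_≡_)

module Doubling where

  open import Data.Nat using (ℕ; zero; suc; z≤n; s≤s; _≤_; _<_; _*_)
  open import Data.Nat.Properties using (m≤n⇒m≤1+n; <-trans; n<1+n)
  open import Data.Sum using (_⊎_; inj₁; inj₂)
  open import Relation.Binary.PropositionalEquality using (_≡_; refl; cong; trans)
  import Data.Nat.Tactic.RingSolver as NS

  double : ℕ → ℕ
  double zero    = 0
  double (suc k) = suc (suc (double k))

  halve : ℕ → ℕ ⊎ ℕ
  halve zero          = inj₁ zero
  halve (suc zero)    = inj₂ zero
  halve (suc (suc d)) with halve d
  ... | inj₁ k = inj₁ (suc k)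
  ... | inj₂ k = inj₂ (suc k)

  halve-double : ∀ k → halve (double k) ≡ inj₁ k
  halve-double zero = refl
  halve-double (suc k) rewrite halve-double k = refl

  halve-suc-double : ∀ k → halve (suc (double k)) ≡ inj₂ k
  halve-suc-double zero = refl
  halve-suc-double (suc k) rewrite halve-suc-double k = refl

  halve≡inj₁⇒double : ∀ d {k} → halve d ≡ inj₁ k → d ≡ double k
  halve≡inj₁⇒double zero refl = refl
  halve≡inj₁⇒double (suc zero) ()
  halve≡inj₁⇒double (suc (suc d)) e with halve d in eq
  halve≡inj₁⇒double (suc (suc d)) refl | inj₁ k = cong (λ z → suc (suc z)) (halve≡inj₁⇒double d eq)

  halve≡inj₂⇒suc-double : ∀ d {k} → halve d ≡ inj₂ k → d ≡ suc (double k)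
  halve≡inj₂⇒suc-double zero ()
  halve≡inj₂⇒suc-double (suc zero) refl = refl
  halve≡inj₂⇒suc-double (suc (suc d)) e with halve d in eq
  halve≡inj₂⇒suc-double (suc (suc d)) refl | inj₂ k = cong (λ z → suc (suc z)) (halve≡inj₂⇒suc-double d eq)

  double-mono-≤ : ∀ {a b} → a ≤ b → double a ≤ double b
  double-mono-≤ z≤n     = z≤n
  double-mono-≤ (s≤s h) = s≤s (s≤s (double-mono-≤ h))

  double-mono-< : ∀ {a b} → a < b → double a < double b
  double-mono-< (s≤s h) = s≤s (m≤n⇒m≤1+n (double-mono-≤ h))

  double-cancel-≤ : ∀ {a b} → double a ≤ double b → a ≤ b
  double-cancel-≤ {zero}  _ = z≤n
  double-cancel-≤ {suc a} {zero} ()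
  double-cancel-≤ {suc a} {suc b} (s≤s (s≤s h)) = s≤s (double-cancel-≤ h)

  double-cancel-< : ∀ {a b} → double a < double b → a < b
  double-cancel-< {a} {zero} ()
  double-cancel-< {zero}  {suc b} _ = s≤s z≤n
  double-cancel-< {suc a} {suc b} (s≤s (s≤s h)) = s≤s (double-cancel-< h)

  suc-double≤double⇒< : ∀ {a b} → suc (double a) ≤ double b → a < b
  suc-double≤double⇒< {a} {zero} ()
  suc-double≤double⇒< {zero}  {suc b} _ = s≤s z≤n
  suc-double≤double⇒< {suc a} {suc b} (s≤s (s≤s h)) = s≤s (suc-double≤double⇒< h)

  suc-double<double⇒< : ∀ {a b} → suc (double a) < double b → a < b
  suc-double<double⇒< {a} h = double-cancel-< (<-trans (n<1+n (double a)) h)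

  double≡2* : ∀ k → double k ≡ 2 * k
  double≡2* zero    = refl
  double≡2* (suc k) = trans (cong (λ z → suc (suc z)) (double≡2* k)) (lemma k)
    where
      lemma : ∀ k → suc (suc (2 * k)) ≡ 2 * suc k
      lemma = NS.solve-∀

module NonNegative where

  open import Data.Nat as ℕ using (ℕ; zero; suc; z≤n)
  import Data.Nat.Properties as ℕP
  open import Data.Nat.Divisibility as ℕD using ()
  open import Data.Integer as ℤ using (ℤ; +_; _+_; _-_; -_; _*_; 0ℤ; 1ℤ; _≤_; _<_; +≤+; +<+)
  import Data.Integer.Properties as ℤP
  open import Data.Integer.Divisibility using (_∣_)
  open import Relation.Binary.PropositionalEquality
  open import Relation.Nullary using (¬_)
  open import Data.Integer.Tactic.RingSolver
  open Doubling using (double)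

  pos-suc : ∀ k → + suc k ≡ 1ℤ + + k
  pos-suc = ℤP.pos-+ 1

  pos-double : ∀ k → + double k ≡ + k + + k
  pos-double zero    = refl
  pos-double (suc k) = begin
    + suc (suc (double k))     ≡⟨ pos-suc (suc (double k)) ⟩
    1ℤ + + suc (double k)      ≡⟨ cong (λ z → 1ℤ + z) (pos-suc (double k)) ⟩
    1ℤ + (1ℤ + + double k)     ≡⟨ cong (λ z → 1ℤ + (1ℤ + z)) (pos-double k) ⟩
    1ℤ + (1ℤ + (+ k + + k))    ≡⟨ lemma (+ k) ⟩
    (1ℤ + + k) + (1ℤ + + k)    ≡⟨ cong₂ _+_ (pos-suc k) (pos-suc k) ⟨
    + suc k + + suc k          ∎
    where
      open ≡-Reasoning
      lemma : ∀ K → 1ℤ + (1ℤ + (K + K)) ≡ (1ℤ + K) + (1ℤ + K)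
      lemma = solve-∀

  NonNeg : ℤ → Set
  NonNeg x = 0ℤ ≤ x

  infixl 6 _⊕_
  infixl 7 _⊛_

  _⊕_ : ∀ {a b} → NonNeg a → NonNeg b → NonNeg (a + b)
  +≤+ _ ⊕ +≤+ _ = +≤+ z≤n

  _⊛_ : ∀ {a b} → NonNeg a → NonNeg b → NonNeg (a * b)
  _⊛_ {+ m} {+ n} (+≤+ _) (+≤+ _) = subst NonNeg (ℤP.pos-* m n) (+≤+ z≤n)

  nonNeg-ℕ : ∀ k → NonNeg (+ k)
  nonNeg-ℕ k = +≤+ z≤n

  nonNeg-≡ : ∀ {a b} → a ≡ b → NonNeg a → NonNeg b
  nonNeg-≡ = subst NonNeg

  nonNeg-gap : ∀ {a b : ℕ} → a ℕ.≤ b → NonNeg (+ b - + a)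
  nonNeg-gap {a} {b} a≤b =
    nonNeg-≡ (sym (trans (ℤP.m-n≡m⊖n b a) (ℤP.⊖-≥ a≤b))) (nonNeg-ℕ _)

  nonNeg-gap-1 : ∀ {a b : ℕ} → a ℕ.< b → NonNeg (+ b - + a - 1ℤ)
  nonNeg-gap-1 {a} {b} a<b =
    nonNeg-≡ (trans (cong (λ z → + b - z) (pos-suc a)) (lemma (+ b) (+ a))) (nonNeg-gap a<b)
    where
      lemma : ∀ B A → B - (1ℤ + A) ≡ B - A - 1ℤ
      lemma = solve-∀

  nonNeg-gap-2 : ∀ {a b : ℕ} → suc (suc a) ℕ.≤ b → NonNeg (+ b - + a - + 2)
  nonNeg-gap-2 {a} {b} h =
    nonNeg-≡ (trans (cong (λ z → + b - z) (trans (pos-suc (suc a)) (cong (λ z → 1ℤ + z) (pos-suc a))))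
                    (lemma (+ b) (+ a)))
             (nonNeg-gap h)
    where
      lemma : ∀ B A → B - (1ℤ + (1ℤ + A)) ≡ B - A - + 2
      lemma = solve-∀

  nonNeg⇒≤ : ∀ {x y} → NonNeg (y - x) → x ≤ y
  nonNeg⇒≤ = ℤP.0≤i-j⇒j≤i

  nonNeg⇒< : ∀ {x y} → NonNeg (y - x - 1ℤ) → x < y
  nonNeg⇒< {x} {y} h = ℤP.≤∧≢⇒< (nonNeg⇒≤ (nonNeg-≡ (lemma x y) (h ⊕ nonNeg-ℕ 1))) x≢y
    where
      lemma : ∀ x y → (y - x - 1ℤ) + 1ℤ ≡ y - x
      lemma = solve-∀
      x-x-1 : ∀ x → x - x - 1ℤ ≡ - 1ℤ
      x-x-1 = solve-∀
      x≢y : x ≢ y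
      x≢y refl with nonNeg-≡ (x-x-1 x) h
      ... | ()

  ≤-from-nonNeg : ∀ {x y z} → y - x ≡ z → NonNeg z → x ≤ y
  ≤-from-nonNeg eq z≥0 = nonNeg⇒≤ (nonNeg-≡ (sym eq) z≥0)

  <-from-nonNeg : ∀ {x y z} → y - x - 1ℤ ≡ z → NonNeg z → x < y
  <-from-nonNeg eq z≥0 = nonNeg⇒< (nonNeg-≡ (sym eq) z≥0)

  ∤-positive-below : ∀ (M : ℕ) (z : ℤ) → 0ℤ < z → z < + M → ¬ ((+ M) ∣ z)
  ∤-positive-below M (+ suc m) (+<+ _) (+<+ m<M) M∣z = ℕP.<⇒≱ m<M (ℕD.∣⇒≤ M∣z)

  ∤-gap : ∀ (M : ℕ) {x y : ℤ} → x < y → y - x < + M → ¬ ((+ M) ∣ (y - x))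
  ∤-gap M {x} {y} x<y = ∤-positive-below M (y - x) (subst (_< y - x) (ℤP.+-inverseʳ x) (ℤP.+-monoˡ-< (- x) x<y))

  ∤-gap-sym : ∀ (M : ℕ) {x y : ℤ} → x < y → y - x < + M → ¬ ((+ M) ∣ (x - y))
  ∤-gap-sym M {x} {y} x<y gap M∣x-y = ∤-gap M x<y gap (subst (ℕD._∣_ M) (ℤP.∣i-j∣≡∣j-i∣ x y) M∣x-y)

module Congruence (n : ℕ) {{_ : NonZero n}} where

  open import Data.Nat using (suc; _<_; _+_; _∸_; _*_; >-nonZero⁻¹)
  open import Data.Nat.Properties using (+-assoc; +-comm; m+[n∸m]≡n; <⇒≤)
  open import Data.Nat.DivMod
  open import Relation.Binary.PropositionalEquality using (_≡_; refl; sym; trans; cong; cong₂)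

  infix 4 _≋_
  _≋_ : ℕ → ℕ → Set
  a ≋ b = a % n ≡ b % n

  ≋-refl : ∀ {a} → a ≋ a
  ≋-refl = refl

  ≋-sym : ∀ {a b} → a ≋ b → b ≋ a
  ≋-sym = sym

  ≋-trans : ∀ {a b c} → a ≋ b → b ≋ c → a ≋ c
  ≋-trans = trans

  ≡⇒≋ : ∀ {a b} → a ≡ b → a ≋ b
  ≡⇒≋ = cong (_% n)

  ≋-+ : ∀ {a b c d} → a ≋ b → c ≋ d → a + c ≋ b + d
  ≋-+ {a} {b} {c} {d} a≋b c≋d =
    trans (%-distribˡ-+ a c n) (trans (cong₂ (λ x y → (x + y) % n) a≋b c≋d) (sym (%-distribˡ-+ b d n)))

  ≋-* : ∀ {a b c d} → a ≋ b → c ≋ d → a * c ≋ b * d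
  ≋-* {a} {b} {c} {d} a≋b c≋d =
    trans (%-distribˡ-* a c n) (trans (cong₂ (λ x y → (x * y) % n) a≋b c≋d) (sym (%-distribˡ-* b d n)))

  %-≋ : ∀ a → a % n ≋ a
  %-≋ a = m%n%n≡m%n a n

  +n-≋ : ∀ a → a + n ≋ a
  +n-≋ a = [m+n]%n≡m%n a n

  ≋⇒≡ : ∀ {a b} → a ≋ b → a < n → b < n → a ≡ b
  ≋⇒≡ {a} {b} a≋b a<n b<n = trans (sym (m<n⇒m%n≡m a<n)) (trans a≋b (m<n⇒m%n≡m b<n))

  suc-≋⇒≋-pred : ∀ {x y} → suc x ≋ y → x ≋ y + (n ∸ 1)
  suc-≋⇒≋-pred {x} {y} 1+x≋y =
    ≋-trans (≋-sym (+n-≋ x)) (≋-trans (≡⇒≋ x+n≡1+x+[n∸1]) (≋-+ 1+x≋y (≋-refl {n ∸ 1})))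
    where
      x+n≡1+x+[n∸1] : x + n ≡ suc x + (n ∸ 1)
      x+n≡1+x+[n∸1] = trans (cong (x +_) (sym (m+[n∸m]≡n (>-nonZero⁻¹ n))))
                            (trans (sym (+-assoc x 1 (n ∸ 1))) (cong (_+ (n ∸ 1)) (+-comm x 1)))

  ≋-cancelʳ : ∀ {a b} x → a + x ≋ b + x → a ≋ b
  ≋-cancelʳ {a} {b} x a+x≋b+x =
    ≋-trans (≋-sym (+n-≋ a)) (≋-trans (≡⇒≋ (sym (complete a)))
      (≋-trans (≋-+ (≋-+ (≋-refl {a}) (%-≋ x)) (≋-refl {n ∸ x % n}))
        (≋-trans (≋-+ a+x≋b+x (≋-refl {n ∸ x % n}))
          (≋-trans (≋-sym (≋-+ (≋-+ (≋-refl {b}) (%-≋ x)) (≋-refl {n ∸ x % n})))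
            (≋-trans (≡⇒≋ (complete b)) (+n-≋ b))))))
    where
      complete : ∀ y → y + x % n + (n ∸ x % n) ≡ y + n
      complete y = trans (+-assoc y (x % n) (n ∸ x % n)) (cong (y +_) (m+[n∸m]≡n (<⇒≤ (m%n<n x n))))

module Profile where

  open import Data.Nat as ℕ using (zero; suc; _≤_; _<_)
  import Data.Nat.Properties as ℕP
  open import Data.Integer as ℤ using (ℤ; +_; _+_; _-_; -_; _*_; 0ℤ; 1ℤ)
  import Data.Integer.Properties as ℤP
  open import Relation.Binary.PropositionalEquality
  open import Relation.Nullary using (yes; no)
  open import Data.Integer.Tactic.RingSolver
  open Doubling using (double)
  open NonNegative

  prefix : (ℕ → ℤ) → ℕ → ℤ
  prefix w zero    = 0ℤ
  prefix w (suc e) = prefix w e + w e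

  -- A line is read as w : ℕ → ℤ, w d being its entry on diagonal d. F₁, F₂, κ, κ′ are the low-order
  -- parts of the entries on the families E and O, C and D, X, S; δ is the drop from E to O (and C to D).
  module Shape (n q G : ℕ) (F₁ F₂ : ℕ → ℤ) (δ κ κ′ : ℤ) where

    p : ℕ
    p = suc q

    N g P : ℤ
    N = + n
    g = + G
    P = + p

    entryE entryO entryC entryD : ℕ → ℤ
    entryE k = - ((g + + k + + k) * N + F₁ k)
    entryO k = (g + + k + + k + 1ℤ) * N + F₁ k - δ
    entryC j = (g + P + P + + 2 + + j + + j) * N + F₂ j
    entryD j = - ((g + P + P + + 3 + + j + + j) * N + F₂ j - δ)

    entryX entryS : ℤ
    entryX = - ((g + P + P + + 2) * N) + κ
    entryS = (g + P + P + 1ℤ) * N - κ′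

    beforeE beforeO beforeC beforeD : ℕ → ℤ
    beforeE k = + k * (N - δ)
    beforeO k = - ((g + + k) * N) - + k * δ - F₁ k
    beforeC j = - ((g + P + + 2 + + j) * N) - (P - + j) * δ + κ
    beforeD j = (P + + j) * N - (P - + j) * δ + κ + F₂ j

    L : ℕ
    L = suc (double q ℕ.+ double p)

    lo hi : ℤ
    lo = - ((g + P + P + 1ℤ) * N) - 1ℤ
    hi = P * N + P * N

    P-1≥0 : NonNeg (P - 1ℤ)
    P-1≥0 = subst NonNeg (lemma P) (nonNeg-gap-1 {0} {p} (ℕ.s≤s ℕ.z≤n))
      where
        lemma : ∀ P → P - + 0 - 1ℤ ≡ P - 1ℤ
        lemma = solve-∀

    modulus : ℕ
    modulus = 2 ℕ.* (4 ℕ.* p ℕ.+ G) ℕ.* n ℕ.+ 1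

    width<modulus : 1 ≤ n → hi - lo ℤ.< + modulus
    width<modulus 1≤n = subst (hi - lo ℤ.<_) (sym modulus-as-ℤ)
      (<-from-nonNeg (lemma N g P)
        (nonNeg-ℕ 4 ⊛ P-1≥0 ⊛ nonNeg-ℕ n ⊕ nonNeg-ℕ 2 ⊛ nonNeg-ℕ n ⊕ nonNeg-ℕ G ⊛ nonNeg-ℕ n
           ⊕ nonNeg-gap 1≤n))
      where
        lemma : ∀ N g P → (+ 2 * (+ 4 * P + g) * N + 1ℤ) - (P * N + P * N - (- ((g + P + P + 1ℤ) * N) - 1ℤ)) - 1ℤ
                          ≡ + 4 * (P - 1ℤ) * N + + 2 * N + g * N + (N - + 1)
        lemma = solve-∀
        modulus-as-ℤ : + modulus ≡ + 2 * (+ 4 * P + g) * N + 1ℤ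
        modulus-as-ℤ = trans (ℤP.pos-+ (2 ℕ.* (4 ℕ.* p ℕ.+ G) ℕ.* n) 1)
          (cong (_+ 1ℤ) (trans (ℤP.pos-* (2 ℕ.* (4 ℕ.* p ℕ.+ G)) n)
            (cong (_* N) (trans (ℤP.pos-* 2 (4 ℕ.* p ℕ.+ G))
              (cong (+ 2 *_) (trans (ℤP.pos-+ (4 ℕ.* p) G) (cong (_+ g) (ℤP.pos-* 4 p))))))))

    record Fits (w : ℕ → ℤ) (s : ℕ) : Set where
      field
        at-E    : ∀ k → k < p → w (double k) ≡ entryE k
        at-O    : ∀ k → k < p → w (suc (double k)) ≡ entryO k
        at-X    : w (double p) ≡ entryX
        at-C    : ∀ j → j < q → w (suc (double j ℕ.+ double p)) ≡ entryC j
        at-D    : ∀ j → j < q → w (suc (suc (double j ℕ.+ double p))) ≡ entryD j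
        at-gap  : ∀ e → L ≤ e → e < s → w e ≡ 0ℤ
        at-S    : w s ≡ entryS
        at-tail : ∀ e → s < e → w e ≡ 0ℤ
        L≤s     : L ≤ s

    module _ {w : ℕ → ℤ} {s : ℕ} (fits : Fits w s) where
      open Fits fits

      prefix-E : ∀ k → k ≤ p → prefix w (double k) ≡ beforeE k
      prefix-E zero    _    = refl
      prefix-E (suc k) k<p = begin
        prefix w (double k) + w (double k) + w (suc (double k))
          ≡⟨ cong₂ _+_ (cong₂ _+_ (prefix-E k (ℕP.<⇒≤ k<p)) (at-E k k<p)) (at-O k k<p) ⟩
        beforeE k + entryE k + entryO k
          ≡⟨ lemma (+ k) g N (F₁ k) δ ⟩
        (1ℤ + + k) * (N - δ)
          ≡⟨ cong (_* (N - δ)) (pos-suc k) ⟨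
        beforeE (suc k) ∎
        where
          open ≡-Reasoning
          lemma : ∀ K g N F δ → K * (N - δ) + - ((g + K + K) * N + F) + ((g + K + K + 1ℤ) * N + F - δ)
                    ≡ (1ℤ + K) * (N - δ)
          lemma = solve-∀

      prefix-O : ∀ k → k < p → prefix w (suc (double k)) ≡ beforeO k
      prefix-O k k<p = trans (cong₂ _+_ (prefix-E k (ℕP.<⇒≤ k<p)) (at-E k k<p)) (lemma (+ k) g N (F₁ k) δ)
        where
          lemma : ∀ K g N F δ → K * (N - δ) + - ((g + K + K) * N + F) ≡ - ((g + K) * N) - K * δ - F
          lemma = solve-∀

      prefix-C : ∀ j → j ≤ q → prefix w (suc (double j ℕ.+ double p)) ≡ beforeC j
      prefix-C zero    _    = trans (cong₂ _+_ (prefix-E p ℕP.≤-refl) at-X) (lemma P g N δ κ)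
        where
          lemma : ∀ P g N δ κ → P * (N - δ) + (- ((g + P + P + + 2) * N) + κ)
                    ≡ - ((g + P + + 2 + + 0) * N) - (P - + 0) * δ + κ
          lemma = solve-∀
      prefix-C (suc j) j<q = begin
        prefix w (suc (double j ℕ.+ double p)) + w (suc (double j ℕ.+ double p))
          + w (suc (suc (double j ℕ.+ double p)))
          ≡⟨ cong₂ _+_ (cong₂ _+_ (prefix-C j (ℕP.<⇒≤ j<q)) (at-C j j<q)) (at-D j j<q) ⟩
        beforeC j + entryC j + entryD j
          ≡⟨ lemma P (+ j) g N δ κ (F₂ j) ⟩
        - ((g + P + + 2 + (1ℤ + + j)) * N) - (P - (1ℤ + + j)) * δ + κ
          ≡⟨ cong (λ z → - ((g + P + + 2 + z) * N) - (P - z) * δ + κ) (pos-suc j) ⟨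
        beforeC (suc j) ∎
        where
          open ≡-Reasoning
          lemma : ∀ P J g N δ κ F →
                  - ((g + P + + 2 + J) * N) - (P - J) * δ + κ + ((g + P + P + + 2 + J + J) * N + F)
                    + - ((g + P + P + + 3 + J + J) * N + F - δ)
                  ≡ - ((g + P + + 2 + (1ℤ + J)) * N) - (P - (1ℤ + J)) * δ + κ
          lemma = solve-∀

      prefix-D : ∀ j → j < q → prefix w (suc (suc (double j ℕ.+ double p))) ≡ beforeD j
      prefix-D j j<q = trans (cong₂ _+_ (prefix-C j (ℕP.<⇒≤ j<q)) (at-C j j<q)) (lemma P (+ j) g N δ κ (F₂ j))
        where
          lemma : ∀ P J g N δ κ F →
                  - ((g + P + + 2 + J) * N) - (P - J) * δ + κ + ((g + P + P + + 2 + J + J) * N + F)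
                  ≡ (P + J) * N - (P - J) * δ + κ + F
          lemma = solve-∀

      prefix-gap : ∀ m → L ≤ m → m ≤ s → prefix w m ≡ beforeC q
      prefix-gap zero    () _
      prefix-gap (suc m) L≤1+m 1+m≤s with L ℕP.≤? m
      ... | yes L≤m = trans (cong₂ _+_ (prefix-gap m L≤m (ℕP.<⇒≤ 1+m≤s)) (at-gap m L≤m 1+m≤s))
                            (ℤP.+-identityʳ (beforeC q))
      ... | no  L≰m = subst (λ z → prefix w z ≡ beforeC q) (ℕP.≤-antisym L≤1+m (ℕP.≰⇒> L≰m))
                            (prefix-C q ℕP.≤-refl)

      prefix-after-S : κ - κ′ ≡ δ → prefix w (suc s) ≡ 0ℤ
      prefix-after-S balanced = begin
        prefix w s + w s                ≡⟨ cong₂ _+_ (prefix-gap s L≤s ℕP.≤-refl) at-S ⟩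
        beforeC q + entryS              ≡⟨ cong (λ X → - ((g + X + + 2 + + q) * N) - (X - + q) * δ + κ
                                                         + ((g + X + X + 1ℤ) * N - κ′)) (pos-suc q) ⟩
        _                               ≡⟨ lemma (+ q) g N δ κ κ′ ⟩
        κ - κ′ - δ                      ≡⟨ cong (_- δ) balanced ⟩
        δ - δ                           ≡⟨ ℤP.+-inverseʳ δ ⟩
        0ℤ                              ∎
        where
          open ≡-Reasoning
          lemma : ∀ Q g N δ κ κ′ → - ((g + (1ℤ + Q) + + 2 + Q) * N) - ((1ℤ + Q) - Q) * δ + κ
                                     + ((g + (1ℤ + Q) + (1ℤ + Q) + 1ℤ) * N - κ′)
                                   ≡ κ - κ′ - δ
          lemma = solve-∀

      prefix-beyond-S : κ - κ′ ≡ δ → ∀ m → s < m → prefix w m ≡ 0ℤ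
      prefix-beyond-S balanced (suc m) s<1+m with s ℕP.<? m
      ... | yes s<m = trans (cong₂ _+_ (prefix-beyond-S balanced m s<m) (at-tail m s<m)) refl
      ... | no  s≮m = subst (λ z → prefix w z ≡ 0ℤ)
                            (cong suc (ℕP.≤-antisym (ℕP.≤-pred s<1+m) (ℕP.≮⇒≥ s≮m)))
                            (prefix-after-S balanced)

module Spread where

  open import Data.Nat as ℕ using (suc; z≤n; s≤s)
  import Data.Nat.Properties as ℕP
  open import Data.Integer as ℤ using (ℤ; +_; _+_; _-_; _≤_; _<_)
  import Data.Integer.Properties as ℤP
  open import Data.Integer.Divisibility using (_∣_)
  open import Relation.Binary.PropositionalEquality
  open import Relation.Binary.Definitions using (tri<; tri≈; tri>)
  open import Relation.Nullary using (¬_)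
  open import Data.Empty using (⊥-elim)
  open import Data.Sum using (_⊎_; inj₁; inj₂)
  open import Data.Integer.Tactic.RingSolver
  open NonNegative

  data Tag : Set where
    tE tO tC tD : ℕ → Tag

  Valid : ℕ → Tag → Set
  Valid q (tE k) = k ℕ.≤ suc q
  Valid q (tO k) = k ℕ.< suc q
  Valid q (tC j) = j ℕ.≤ q
  Valid q (tD j) = j ℕ.< q

  record Sorted (q : ℕ) (vE vO vC vD : ℕ → ℤ) (lo hi : ℤ) : Set where
    field
      E-increasing : ∀ k k′ → k ℕ.< k′ → k′ ℕ.≤ suc q → vE k < vE k′
      O-decreasing : ∀ k k′ → k ℕ.< k′ → k′ ℕ.< suc q → vO k′ < vO k
      C-decreasing : ∀ j j′ → j ℕ.< j′ → j′ ℕ.≤ q → vC j′ < vC j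
      D-increasing : ∀ j j′ → j ℕ.< j′ → j′ ℕ.< q → vD j < vD j′
      C<O : ∀ j k → j ℕ.≤ q → k ℕ.< suc q → vC j < vO k
      O<E : ∀ k k′ → k ℕ.< suc q → k′ ℕ.≤ suc q → vO k < vE k′
      E<D : ∀ k j → k ℕ.≤ suc q → j ℕ.< q → vE k < vD j
      lo≤C : ∀ j → j ℕ.≤ q → lo ≤ vC j
      D≤hi : ∀ j → j ℕ.< q → vD j ≤ hi
      E≤hi : ∀ k → k ℕ.≤ suc q → vE k ≤ hi

  module _ {q : ℕ} {vE vO vC vD : ℕ → ℤ} {lo hi : ℤ} (sorted : Sorted q vE vO vC vD lo hi) where
    open Sorted sorted

    value : Tag → ℤ
    value (tE k) = vE k
    value (tO k) = vO k
    value (tC j) = vC j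
    value (tD j) = vD j

    private
      0<p : 0 ℕ.< suc q
      0<p = s≤s z≤n

      C<E : ∀ j k → j ℕ.≤ q → k ℕ.≤ suc q → vC j < vE k
      C<E j k hj hk = ℤP.<-trans (C<O j 0 hj 0<p) (O<E 0 k 0<p hk)

      O<D : ∀ k j → k ℕ.< suc q → j ℕ.< q → vO k < vD j
      O<D k j hk hj = ℤP.<-trans (O<E k 0 hk z≤n) (E<D 0 j z≤n hj)

      C<D : ∀ j j′ → j ℕ.≤ q → j′ ℕ.< q → vC j < vD j′
      C<D j j′ hj hj′ = ℤP.<-trans (C<O j 0 hj 0<p) (O<D 0 j′ 0<p hj′)

    lo≤value : ∀ t → Valid q t → lo ≤ value t
    lo≤value (tC j) v = lo≤C j v
    lo≤value (tO k) v = ℤP.<⇒≤ (ℤP.≤-<-trans (lo≤C 0 z≤n) (C<O 0 k z≤n v))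
    lo≤value (tE k) v = ℤP.<⇒≤ (ℤP.≤-<-trans (lo≤C 0 z≤n) (C<E 0 k z≤n v))
    lo≤value (tD j) v = ℤP.<⇒≤ (ℤP.≤-<-trans (lo≤C 0 z≤n) (C<D 0 j z≤n v))

    value≤hi : ∀ t → Valid q t → value t ≤ hi
    value≤hi (tE k) v = E≤hi k v
    value≤hi (tD j) v = D≤hi j v
    value≤hi (tO k) v = ℤP.<⇒≤ (ℤP.<-≤-trans (O<E k 0 v z≤n) (E≤hi 0 z≤n))
    value≤hi (tC j) v = ℤP.<⇒≤ (ℤP.<-≤-trans (C<E j 0 v z≤n) (E≤hi 0 z≤n))

    distinct-tags-ordered : ∀ t t′ → Valid q t → Valid q t′ → t ≢ t′ →
                        value t < value t′ ⊎ value t′ < value t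
    distinct-tags-ordered (tE k) (tE k′) v v′ t≢t′ with ℕP.<-cmp k k′
    ... | tri< k<k′ _ _ = inj₁ (E-increasing k k′ k<k′ v′)
    ... | tri≈ _ refl _ = ⊥-elim (t≢t′ refl)
    ... | tri> _ _ k′<k = inj₂ (E-increasing k′ k k′<k v)
    distinct-tags-ordered (tO k) (tO k′) v v′ t≢t′ with ℕP.<-cmp k k′
    ... | tri< k<k′ _ _ = inj₂ (O-decreasing k k′ k<k′ v′)
    ... | tri≈ _ refl _ = ⊥-elim (t≢t′ refl)
    ... | tri> _ _ k′<k = inj₁ (O-decreasing k′ k k′<k v)
    distinct-tags-ordered (tC j) (tC j′) v v′ t≢t′ with ℕP.<-cmp j j′
    ... | tri< j<j′ _ _ = inj₂ (C-decreasing j j′ j<j′ v′)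
    ... | tri≈ _ refl _ = ⊥-elim (t≢t′ refl)
    ... | tri> _ _ j′<j = inj₁ (C-decreasing j′ j j′<j v)
    distinct-tags-ordered (tD j) (tD j′) v v′ t≢t′ with ℕP.<-cmp j j′
    ... | tri< j<j′ _ _ = inj₁ (D-increasing j j′ j<j′ v′)
    ... | tri≈ _ refl _ = ⊥-elim (t≢t′ refl)
    ... | tri> _ _ j′<j = inj₂ (D-increasing j′ j j′<j v)
    distinct-tags-ordered (tC j) (tO k) v v′ _ = inj₁ (C<O j k v v′)
    distinct-tags-ordered (tO k) (tC j) v v′ _ = inj₂ (C<O j k v′ v)
    distinct-tags-ordered (tO k) (tE k′) v v′ _ = inj₁ (O<E k k′ v v′)
    distinct-tags-ordered (tE k′) (tO k) v v′ _ = inj₂ (O<E k k′ v′ v)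
    distinct-tags-ordered (tE k) (tD j) v v′ _ = inj₁ (E<D k j v v′)
    distinct-tags-ordered (tD j) (tE k) v v′ _ = inj₂ (E<D k j v′ v)
    distinct-tags-ordered (tC j) (tE k) v v′ _ = inj₁ (C<E j k v v′)
    distinct-tags-ordered (tE k) (tC j) v v′ _ = inj₂ (C<E j k v′ v)
    distinct-tags-ordered (tC j) (tD j′) v v′ _ = inj₁ (C<D j j′ v v′)
    distinct-tags-ordered (tD j′) (tC j) v v′ _ = inj₂ (C<D j j′ v′ v)
    distinct-tags-ordered (tO k) (tD j) v v′ _ = inj₁ (O<D k j v v′)
    distinct-tags-ordered (tD j) (tO k) v v′ _ = inj₂ (O<D k j v′ v)

    gap≤width : ∀ {a b} → lo ≤ a → b ≤ hi → b - a ≤ hi - lo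
    gap≤width {a} {b} lo≤a b≤hi =
      ≤-from-nonNeg (lemma a b lo hi) (ℤP.i≤j⇒0≤j-i b≤hi ⊕ ℤP.i≤j⇒0≤j-i lo≤a)
      where
        lemma : ∀ a b lo hi → (hi - lo) - (b - a) ≡ (hi - b) + (a - lo)
        lemma = solve-∀

    values-distinct-mod : (M : ℕ) → hi - lo < + M → ∀ t t′ → Valid q t → Valid q t′ → t ≢ t′ →
                          ¬ ((+ M) ∣ (value t - value t′))
    values-distinct-mod M width<M t t′ v v′ t≢t′ with distinct-tags-ordered t t′ v v′ t≢t′
    ... | inj₁ t<t′ = ∤-gap-sym M t<t′ (ℤP.≤-<-trans (gap≤width (lo≤value t v) (value≤hi t′ v′)) width<M)
    ... | inj₂ t′<t = ∤-gap M t′<t (ℤP.≤-<-trans (gap≤width (lo≤value t′ v′) (value≤hi t v)) width<M)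

module Regimes where

  open import Data.Nat as ℕ using (suc; s≤s)
  import Data.Nat.Properties as ℕP
  open import Data.Integer as ℤ using (ℤ; +_; _+_; _-_; -_; _*_; 0ℤ; 1ℤ; _≤_; _<_)
  import Data.Integer.Properties as ℤP
  open import Relation.Binary.PropositionalEquality
  open import Data.Product using (_×_; proj₁; proj₂)
  open import Data.Integer.Tactic.RingSolver
  open NonNegative
  open Spread using (Sorted)

  -- Regular covers the columns (δ = 0) and the rows whose X cell is not in column 0 (δ = 1); in the
  -- remaining rows the offsets on O and D wrap round from 0 to n, which is the Wrapped case.
  module Regular (n q G : ℕ) (F₁ F₂ : ℕ → ℤ) (δ κ : ℤ)
    (δ≥0 : NonNeg δ) (δ≤1 : NonNeg (1ℤ - δ)) (κ≥0 : NonNeg κ) (κ<N : NonNeg (+ n - 1ℤ - κ))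
    (N≥4P : NonNeg (+ n - + suc q - + suc q - + suc q - + suc q))
    (F₁-range : ∀ k → k ℕ.< suc q → NonNeg (F₁ k - 1ℤ) × NonNeg (+ n - F₁ k))
    (F₂-range : ∀ j → j ℕ.< q → NonNeg (F₂ j - 1ℤ) × NonNeg (+ n - F₂ j)) where

    open Profile.Shape n q G F₁ F₂ δ κ κ

    private
      split-N-δ-1 : ∀ N P δ → N - δ - 1ℤ ≡ (N - P - P - P - P) + ((P - 1ℤ) + (P - 1ℤ) + (P - 1ℤ) + (P - 1ℤ)) + + 2 + (1ℤ - δ)
      split-N-δ-1 = solve-∀
      split-N-δ : ∀ N δ → N - δ ≡ (N - δ - 1ℤ) + 1ℤ
      split-N-δ = solve-∀
      split-N-P : ∀ N P → N - P ≡ (N - P - P - P - P) + ((P - 1ℤ) + (P - 1ℤ) + (P - 1ℤ)) + + 3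
      split-N-P = solve-∀

    N-δ>0 : NonNeg (N - δ - 1ℤ)
    N-δ>0 = nonNeg-≡ (sym (split-N-δ-1 N P δ)) (N≥4P ⊕ (P-1≥0 ⊕ P-1≥0 ⊕ P-1≥0 ⊕ P-1≥0) ⊕ nonNeg-ℕ 2 ⊕ δ≤1)
    N-δ≥0 : NonNeg (N - δ)
    N-δ≥0 = nonNeg-≡ (sym (split-N-δ N δ)) (N-δ>0 ⊕ nonNeg-ℕ 1)
    N≥P : NonNeg (N - P)
    N≥P = nonNeg-≡ (sym (split-N-P N P)) (N≥4P ⊕ (P-1≥0 ⊕ P-1≥0 ⊕ P-1≥0) ⊕ nonNeg-ℕ 3)
    N≥0 : NonNeg N
    N≥0 = nonNeg-ℕ n

    E-increasing : ∀ k k′ → k ℕ.< k′ → k′ ℕ.≤ suc q → beforeE k < beforeE k′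
    E-increasing k k′ h _ = <-from-nonNeg (lemma (+ k) (+ k′) N δ) (nonNeg-gap-1 h ⊛ N-δ≥0 ⊕ N-δ>0)
      where
        lemma : ∀ K K′ N δ → K′ * (N - δ) - K * (N - δ) - 1ℤ ≡ (K′ - K - 1ℤ) * (N - δ) + (N - δ - 1ℤ)
        lemma = solve-∀

    O-decreasing : ∀ k k′ → k ℕ.< k′ → k′ ℕ.< suc q → beforeO k′ < beforeO k
    O-decreasing k k′ h h′ = <-from-nonNeg (lemma (+ k) (+ k′) N δ g (F₁ k) (F₁ k′))
      (nonNeg-gap-1 h ⊛ N≥0 ⊕ proj₂ (F₁-range k (ℕP.<-trans h h′)) ⊕ proj₁ (F₁-range k′ h′)
         ⊕ nonNeg-gap-1 h ⊛ δ≥0 ⊕ δ≥0)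
      where
        lemma : ∀ K K′ N δ g F F′ → (- ((g + K) * N) - K * δ - F) - (- ((g + K′) * N) - K′ * δ - F′) - 1ℤ
              ≡ (K′ - K - 1ℤ) * N + (N - F) + (F′ - 1ℤ) + (K′ - K - 1ℤ) * δ + δ
        lemma = solve-∀

    C-decreasing : ∀ j j′ → j ℕ.< j′ → j′ ℕ.≤ q → beforeC j′ < beforeC j
    C-decreasing j j′ h _ = <-from-nonNeg (lemma (+ j) (+ j′) N δ g P κ) (nonNeg-gap-1 h ⊛ N-δ≥0 ⊕ N-δ>0)
      where
        lemma : ∀ J J′ N δ g P κ → (- ((g + P + + 2 + J) * N) - (P - J) * δ + κ)
                                   - (- ((g + P + + 2 + J′) * N) - (P - J′) * δ + κ) - 1ℤ
              ≡ (J′ - J - 1ℤ) * (N - δ) + (N - δ - 1ℤ)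
        lemma = solve-∀

    D-increasing : ∀ j j′ → j ℕ.< j′ → j′ ℕ.< q → beforeD j < beforeD j′
    D-increasing j j′ h h′ = <-from-nonNeg (lemma (+ j) (+ j′) N δ P κ (F₂ j) (F₂ j′))
      (nonNeg-gap-1 h ⊛ N≥0 ⊕ nonNeg-gap-1 h ⊛ δ≥0 ⊕ δ≥0
         ⊕ proj₂ (F₂-range j (ℕP.<-trans h h′)) ⊕ proj₁ (F₂-range j′ h′))
      where
        lemma : ∀ J J′ N δ P κ F F′ → ((P + J′) * N - (P - J′) * δ + κ + F′)
                                      - ((P + J) * N - (P - J) * δ + κ + F) - 1ℤ
              ≡ (J′ - J - 1ℤ) * N + (J′ - J - 1ℤ) * δ + δ + (N - F) + (F′ - 1ℤ)
        lemma = solve-∀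

    ceilC floorO : ℤ
    ceilC = - ((g + P + 1ℤ) * N) - 1ℤ
    floorO = - ((g + P) * N) - P

    C≤ceilC : ∀ j → j ℕ.≤ q → beforeC j ≤ ceilC
    C≤ceilC j h = ≤-from-nonNeg (lemma (+ j) N δ g P κ)
      (nonNeg-ℕ j ⊛ N≥0 ⊕ κ<N ⊕ nonNeg-gap (ℕP.m≤n⇒m≤1+n h) ⊛ δ≥0)
      where
        lemma : ∀ J N δ g P κ → (- ((g + P + 1ℤ) * N) - 1ℤ) - (- ((g + P + + 2 + J) * N) - (P - J) * δ + κ)
              ≡ J * N + (N - 1ℤ - κ) + (P - J) * δ
        lemma = solve-∀

    ceilC<floorO : ceilC < floorO
    ceilC<floorO = <-from-nonNeg (lemma N g P) N≥P
      where
        lemma : ∀ N g P → (- ((g + P) * N) - P) - (- ((g + P + 1ℤ) * N) - 1ℤ) - 1ℤ ≡ N - P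
        lemma = solve-∀

    floorO≤O : ∀ k → k ℕ.< suc q → floorO ≤ beforeO k
    floorO≤O k h = ≤-from-nonNeg (lemma (+ k) N δ g P (F₁ k))
      (nonNeg-gap-1 h ⊛ N≥0 ⊕ proj₂ (F₁-range k h) ⊕ nonNeg-gap-1 h ⊕ nonNeg-ℕ 1 ⊕ nonNeg-ℕ k ⊛ δ≤1)
      where
        lemma : ∀ K N δ g P F → (- ((g + K) * N) - K * δ - F) - (- ((g + P) * N) - P)
              ≡ (P - K - 1ℤ) * N + (N - F) + (P - K - 1ℤ) + 1ℤ + K * (1ℤ - δ)
        lemma = solve-∀

    C<O : ∀ j k → j ℕ.≤ q → k ℕ.< suc q → beforeC j < beforeO k
    C<O j k hj hk = ℤP.≤-<-trans (C≤ceilC j hj) (ℤP.<-≤-trans ceilC<floorO (floorO≤O k hk))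

    O<E : ∀ k k′ → k ℕ.< suc q → k′ ℕ.≤ suc q → beforeO k < beforeE k′
    O<E k k′ hk _ = <-from-nonNeg (lemma (+ k) (+ k′) N δ g (F₁ k))
      (nonNeg-ℕ k′ ⊛ N-δ≥0 ⊕ nonNeg-ℕ G ⊛ N≥0 ⊕ nonNeg-ℕ k ⊛ N≥0 ⊕ nonNeg-ℕ k ⊛ δ≥0
         ⊕ proj₁ (F₁-range k hk))
      where
        lemma : ∀ K K′ N δ g F → K′ * (N - δ) - (- ((g + K) * N) - K * δ - F) - 1ℤ
              ≡ K′ * (N - δ) + g * N + K * N + K * δ + (F - 1ℤ)
        lemma = solve-∀

    E<D : ∀ k j → k ℕ.≤ suc q → j ℕ.< q → beforeE k < beforeD j
    E<D k j hk hj = <-from-nonNeg (lemma (+ k) (+ j) N δ P κ (F₂ j))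
      (nonNeg-gap hk ⊛ N-δ≥0 ⊕ nonNeg-ℕ j ⊛ N≥0 ⊕ nonNeg-ℕ j ⊛ δ≥0 ⊕ κ≥0 ⊕ proj₁ (F₂-range j hj))
      where
        lemma : ∀ K J N δ P κ F → ((P + J) * N - (P - J) * δ + κ + F) - K * (N - δ) - 1ℤ
              ≡ (P - K) * (N - δ) + J * N + J * δ + κ + (F - 1ℤ)
        lemma = solve-∀

    lo≤C : ∀ j → j ℕ.≤ q → lo ≤ beforeC j
    lo≤C j h = ≤-from-nonNeg (lemma (+ j) N δ g P κ) (nonNeg-gap-1 (s≤s h) ⊛ N-δ≥0 ⊕ δ≤1 ⊕ κ≥0)
      where
        lemma : ∀ J N δ g P κ → (- ((g + P + + 2 + J) * N) - (P - J) * δ + κ) - (- ((g + P + P + 1ℤ) * N) - 1ℤ)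
              ≡ (P - J - 1ℤ) * (N - δ) + (1ℤ - δ) + κ
        lemma = solve-∀

    D≤hi : ∀ j → j ℕ.< q → beforeD j ≤ hi
    D≤hi j h = ≤-from-nonNeg (lemma (+ j) N δ P κ (F₂ j))
      (nonNeg-gap-2 (s≤s h) ⊛ N≥0 ⊕ κ<N ⊕ proj₂ (F₂-range j h) ⊕ nonNeg-ℕ 1
         ⊕ nonNeg-gap (ℕP.<⇒≤ (ℕP.m<n⇒m<1+n h)) ⊛ δ≥0)
      where
        lemma : ∀ J N δ P κ F → (P * N + P * N) - ((P + J) * N - (P - J) * δ + κ + F)
              ≡ (P - J - + 2) * N + (N - 1ℤ - κ) + (N - F) + 1ℤ + (P - J) * δ
        lemma = solve-∀

    E≤hi : ∀ k → k ℕ.≤ suc q → beforeE k ≤ hi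
    E≤hi k h = ≤-from-nonNeg (lemma (+ k) N δ P)
      (nonNeg-gap h ⊛ N≥0 ⊕ nonNeg-ℕ (suc q) ⊛ N≥0 ⊕ nonNeg-ℕ k ⊛ δ≥0)
      where
        lemma : ∀ K N δ P → (P * N + P * N) - K * (N - δ) ≡ (P - K) * N + P * N + K * δ
        lemma = solve-∀

    sorted : Sorted q beforeE beforeO beforeC beforeD lo hi
    sorted = record
      { E-increasing = E-increasing ; O-decreasing = O-decreasing
      ; C-decreasing = C-decreasing ; D-increasing = D-increasing
      ; C<O = C<O ; O<E = O<E ; E<D = E<D
      ; lo≤C = lo≤C ; D≤hi = D≤hi ; E≤hi = E≤hi }

  module Wrapped (n q G : ℕ) (N≥1 : NonNeg (+ n - 1ℤ)) where

    open Profile.Shape n q G (λ _ → 1ℤ) (λ _ → 1ℤ) (1ℤ - + n) 0ℤ 0ℤ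

    N≥0 : NonNeg N
    N≥0 = nonNeg-ℕ n

    2N-1≥0 : NonNeg (N - (1ℤ - N))
    2N-1≥0 = nonNeg-≡ (sym (lemma N)) (N≥1 ⊕ N≥0)
      where
        lemma : ∀ N → N - (1ℤ - N) ≡ (N - 1ℤ) + N
        lemma = solve-∀

    E-increasing : ∀ k k′ → k ℕ.< k′ → k′ ℕ.≤ suc q → beforeE k < beforeE k′
    E-increasing k k′ h _ = <-from-nonNeg (lemma (+ k) (+ k′) N) (nonNeg-gap-1 h ⊛ 2N-1≥0 ⊕ N≥1 ⊕ N≥1)
      where
        lemma : ∀ K K′ N → K′ * (N - (1ℤ - N)) - K * (N - (1ℤ - N)) - 1ℤ
                           ≡ (K′ - K - 1ℤ) * (N - (1ℤ - N)) + (N - 1ℤ) + (N - 1ℤ)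
        lemma = solve-∀

    O-decreasing : ∀ k k′ → k ℕ.< k′ → k′ ℕ.< suc q → beforeO k′ < beforeO k
    O-decreasing k k′ h h′ = <-from-nonNeg (lemma (+ k) (+ k′) N g) (nonNeg-gap-1 h)
      where
        lemma : ∀ K K′ N g → (- ((g + K) * N) - K * (1ℤ - N) - 1ℤ) - (- ((g + K′) * N) - K′ * (1ℤ - N) - 1ℤ) - 1ℤ
              ≡ K′ - K - 1ℤ
        lemma = solve-∀

    C-decreasing : ∀ j j′ → j ℕ.< j′ → j′ ℕ.≤ q → beforeC j′ < beforeC j
    C-decreasing j j′ h _ = <-from-nonNeg (lemma (+ j) (+ j′) N g P)
      (nonNeg-gap-1 h ⊛ 2N-1≥0 ⊕ N≥1 ⊕ N≥1)
      where
        lemma : ∀ J J′ N g P → (- ((g + P + + 2 + J) * N) - (P - J) * (1ℤ - N) + 0ℤ)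
                               - (- ((g + P + + 2 + J′) * N) - (P - J′) * (1ℤ - N) + 0ℤ) - 1ℤ
              ≡ (J′ - J - 1ℤ) * (N - (1ℤ - N)) + (N - 1ℤ) + (N - 1ℤ)
        lemma = solve-∀

    D-increasing : ∀ j j′ → j ℕ.< j′ → j′ ℕ.< q → beforeD j < beforeD j′
    D-increasing j j′ h h′ = <-from-nonNeg (lemma (+ j) (+ j′) N P) (nonNeg-gap-1 h)
      where
        lemma : ∀ J J′ N P → ((P + J′) * N - (P - J′) * (1ℤ - N) + 0ℤ + 1ℤ)
                             - ((P + J) * N - (P - J) * (1ℤ - N) + 0ℤ + 1ℤ) - 1ℤ
              ≡ J′ - J - 1ℤ
        lemma = solve-∀

    C<O : ∀ j k → j ℕ.≤ q → k ℕ.< suc q → beforeC j < beforeO k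
    C<O j k hj hk = <-from-nonNeg (lemma (+ j) (+ k) N g P)
      (nonNeg-gap-1 hk ⊕ N≥1 ⊕ N≥0 ⊕ nonNeg-ℕ j ⊛ N≥1 ⊕ nonNeg-ℕ j ⊛ N≥0)
      where
        lemma : ∀ J K N g P → (- ((g + K) * N) - K * (1ℤ - N) - 1ℤ)
                              - (- ((g + P + + 2 + J) * N) - (P - J) * (1ℤ - N) + 0ℤ) - 1ℤ
              ≡ (P - K - 1ℤ) + (N - 1ℤ) + N + J * (N - 1ℤ) + J * N
        lemma = solve-∀

    O<E : ∀ k k′ → k ℕ.< suc q → k′ ℕ.≤ suc q → beforeO k < beforeE k′
    O<E k k′ hk _ = <-from-nonNeg (lemma (+ k) (+ k′) N g)
      (nonNeg-ℕ k′ ⊛ 2N-1≥0 ⊕ nonNeg-ℕ G ⊛ N≥0 ⊕ nonNeg-ℕ k)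
      where
        lemma : ∀ K K′ N g → K′ * (N - (1ℤ - N)) - (- ((g + K) * N) - K * (1ℤ - N) - 1ℤ) - 1ℤ
              ≡ K′ * (N - (1ℤ - N)) + g * N + K
        lemma = solve-∀

    E<D : ∀ k j → k ℕ.≤ suc q → j ℕ.< q → beforeE k < beforeD j
    E<D k j hk hj = <-from-nonNeg (lemma (+ k) (+ j) N P) (nonNeg-gap hk ⊛ 2N-1≥0 ⊕ nonNeg-ℕ j)
      where
        lemma : ∀ K J N P → ((P + J) * N - (P - J) * (1ℤ - N) + 0ℤ + 1ℤ) - K * (N - (1ℤ - N)) - 1ℤ
              ≡ (P - K) * (N - (1ℤ - N)) + J
        lemma = solve-∀

    lo≤C : ∀ j → j ℕ.≤ q → lo ≤ beforeC j
    lo≤C j h = ≤-from-nonNeg (lemma (+ j) N g P) (nonNeg-gap-1 (s≤s h) ⊛ 2N-1≥0 ⊕ N≥0)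
      where
        lemma : ∀ J N g P → (- ((g + P + + 2 + J) * N) - (P - J) * (1ℤ - N) + 0ℤ) - (- ((g + P + P + 1ℤ) * N) - 1ℤ)
              ≡ (P - J - 1ℤ) * (N - (1ℤ - N)) + N
        lemma = solve-∀

    D≤hi : ∀ j → j ℕ.< q → beforeD j ≤ hi
    D≤hi j h = ≤-from-nonNeg (lemma (+ j) N P) (nonNeg-gap-1 (ℕP.m<n⇒m<1+n h))
      where
        lemma : ∀ J N P → (P * N + P * N) - ((P + J) * N - (P - J) * (1ℤ - N) + 0ℤ + 1ℤ) ≡ P - J - 1ℤ
        lemma = solve-∀

    E≤hi : ∀ k → k ℕ.≤ suc q → beforeE k ≤ hi
    E≤hi k h = ≤-from-nonNeg (lemma (+ k) N P) (nonNeg-gap h ⊛ N≥0 ⊕ nonNeg-gap h ⊛ N≥0 ⊕ nonNeg-ℕ k)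
      where
        lemma : ∀ K N P → (P * N + P * N) - K * (N - (1ℤ - N)) ≡ (P - K) * N + (P - K) * N + K
        lemma = solve-∀

    sorted : Sorted q beforeE beforeO beforeC beforeD lo hi
    sorted = record
      { E-increasing = E-increasing ; O-decreasing = O-decreasing
      ; C-decreasing = C-decreasing ; D-increasing = D-increasing
      ; C<O = C<O ; O<E = O<E ; E<D = E<D
      ; lo≤C = lo≤C ; D≤hi = D≤hi ; E≤hi = E≤hi }

module Diagonals where

  open import Data.Nat as ℕ using (suc; s≤s; _≤_; _<_; _+_; _∸_)
  import Data.Nat.Properties as ℕP
  open import Data.Sum using (_⊎_; inj₁; inj₂; [_,_])
  open import Data.Product using (_×_; _,_; proj₁; proj₂)
  open import Data.Empty using (⊥-elim)
  open import Relation.Binary.PropositionalEquality using (_≡_; _≢_; refl; sym; trans; cong; subst)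
  open import Relation.Nullary using (yes; no; ¬_)
  open Doubling

  data Diagonal : Set where
    E O C D : ℕ → Diagonal
    X S none : Diagonal

  module Layout (q s : ℕ) where

    p L : ℕ
    p = suc q
    L = suc (double q + double p)

    classify : ℕ → Diagonal
    classify d with d ℕP.<? double p
    ... | yes _ = [ E , O ] (halve d)
    ... | no _ with d ℕP.≟ double p
    ...   | yes _ = X
    ...   | no _ with d ℕP.<? L
    ...     | yes _ = [ C , D ] (halve (d ∸ suc (double p)))
    ...     | no _ with d ℕP.≟ s
    ...       | yes _ = S
    ...       | no _ = none

    2p≤2p+2j : ∀ j → double p ≤ double j + double p
    2p≤2p+2j j = ℕP.m≤n+m (double p) (double j)

    2p≤L : double p ≤ L
    2p≤L = ℕP.m≤n⇒m≤1+n (2p≤2p+2j q)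

    classify-E : ∀ k → k < p → classify (double k) ≡ E k
    classify-E k k<p with double k ℕP.<? double p
    ... | yes _ rewrite halve-double k = refl
    ... | no ¬lt = ⊥-elim (¬lt (double-mono-< k<p))

    classify-O : ∀ k → k < p → classify (suc (double k)) ≡ O k
    classify-O k k<p with suc (double k) ℕP.<? double p
    ... | yes _ rewrite halve-suc-double k = refl
    ... | no ¬lt = ⊥-elim (¬lt (double-mono-≤ k<p))

    classify-X : classify (double p) ≡ X
    classify-X with double p ℕP.<? double p
    ... | yes lt = ⊥-elim (ℕP.<-irrefl refl lt)
    ... | no _ with double p ℕP.≟ double p
    ...   | yes _ = refl
    ...   | no ¬eq = ⊥-elim (¬eq refl)

    classify-C : ∀ j → j < q → classify (suc (double j + double p)) ≡ C j
    classify-C j j<q with suc (double j + double p) ℕP.<? double p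
    ... | yes lt = ⊥-elim (ℕP.<-irrefl refl (ℕP.<-≤-trans lt (ℕP.m≤n+m (double p) (suc (double j)))))
    ... | no _ with suc (double j + double p) ℕP.≟ double p
    ...   | yes eq = ⊥-elim (ℕP.<-irrefl (sym eq) (s≤s (2p≤2p+2j j)))
    ...   | no _ with suc (double j + double p) ℕP.<? L
    ...     | yes _ rewrite ℕP.m+n∸n≡m (double j) (double p) | halve-double j = refl
    ...     | no ¬lt = ⊥-elim (¬lt (s≤s (ℕP.+-monoˡ-< (double p) (double-mono-< j<q))))

    classify-D : ∀ j → j < q → classify (suc (suc (double j + double p))) ≡ D j
    classify-D j j<q with suc (suc (double j + double p)) ℕP.<? double p
    ... | yes lt = ⊥-elim (ℕP.<-irrefl refl (ℕP.<-≤-trans lt (ℕP.m≤n+m (double p) (suc (suc (double j))))))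
    ... | no _ with suc (suc (double j + double p)) ℕP.≟ double p
    ...   | yes eq = ⊥-elim (ℕP.<-irrefl (sym eq) (s≤s (ℕP.m≤n+m (double p) (suc (double j)))))
    ...   | no _ with suc (suc (double j + double p)) ℕP.<? L
    ...     | yes _ rewrite ℕP.m+n∸n≡m (suc (double j)) (double p) | halve-suc-double j = refl
    ...     | no ¬lt = ⊥-elim (¬lt (s≤s (ℕP.+-monoˡ-< (double p) (double-mono-≤ j<q))))

    classify-S : L ≤ s → classify s ≡ S
    classify-S L≤s with s ℕP.<? double p
    ... | yes lt = ⊥-elim (ℕP.<-irrefl refl (ℕP.<-≤-trans lt (ℕP.≤-trans 2p≤L L≤s)))
    ... | no _ with s ℕP.≟ double p
    ...   | yes eq = ⊥-elim (ℕP.<-irrefl (sym eq) (ℕP.<-≤-trans (s≤s (2p≤2p+2j q)) L≤s))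
    ...   | no _ with s ℕP.<? L
    ...     | yes lt = ⊥-elim (ℕP.<-irrefl refl (ℕP.<-≤-trans lt L≤s))
    ...     | no _ with s ℕP.≟ s
    ...       | yes _ = refl
    ...       | no ¬eq = ⊥-elim (¬eq refl)

    classify-none : ∀ e → L ≤ e → e ≢ s → classify e ≡ none
    classify-none e L≤e e≢s with e ℕP.<? double p
    ... | yes lt = ⊥-elim (ℕP.<-irrefl refl (ℕP.<-≤-trans lt (ℕP.≤-trans 2p≤L L≤e)))
    ... | no _ with e ℕP.≟ double p
    ...   | yes eq = ⊥-elim (ℕP.<-irrefl (sym eq) (ℕP.<-≤-trans (s≤s (2p≤2p+2j q)) L≤e))
    ...   | no _ with e ℕP.<? L
    ...     | yes lt = ⊥-elim (ℕP.<-irrefl refl (ℕP.<-≤-trans lt L≤e))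
    ...     | no _ with e ℕP.≟ s
    ...       | yes eq = ⊥-elim (e≢s eq)
    ...       | no _ = refl

    data View (d : ℕ) : Set where
      vE : ∀ k → k < p → d ≡ double k → View d
      vO : ∀ k → k < p → d ≡ suc (double k) → View d
      vX : d ≡ double p → View d
      vC : ∀ j → j < q → d ≡ suc (double j + double p) → View d
      vD : ∀ j → j < q → d ≡ suc (suc (double j + double p)) → View d
      vS : d ≡ s → View d

    private
      beyond-X : ∀ {d} → ¬ d < double p → d ≢ double p → suc (double p) ≤ d
      beyond-X ¬lt ¬eq = ℕP.≤∧≢⇒< (ℕP.≮⇒≥ ¬lt) (λ eq → ¬eq (sym eq))

      shift-X : ∀ {d} → suc (double p) ≤ d → d ≡ suc ((d ∸ suc (double p)) + double p)
      shift-X {d} le = trans (sym (ℕP.m∸n+n≡m le)) (ℕP.+-suc (d ∸ suc (double p)) (double p))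

    view : ∀ d → classify d ≢ none → View d
    view d ≢none with d ℕP.<? double p
    ... | yes lt with halve d in eq
    ...   | inj₁ k = vE k (double-cancel-< (subst (_< double p) d≡ lt)) d≡
      where d≡ = halve≡inj₁⇒double d eq
    ...   | inj₂ k = vO k (suc-double<double⇒< (subst (_< double p) d≡ lt)) d≡
      where d≡ = halve≡inj₂⇒suc-double d eq
    view d ≢none | no ¬lt with d ℕP.≟ double p
    ...   | yes eq = vX eq
    ...   | no ¬eq with d ℕP.<? L
    ...     | yes lt with halve (d ∸ suc (double p)) in eq
    ...       | inj₁ j =
      vC j (double-cancel-< (ℕP.+-cancelʳ-< (double p) (double j) (double q) (ℕP.≤-pred (subst (_< L) d≡ lt)))) d≡
      where d≡ = trans (shift-X (beyond-X ¬lt ¬eq)) (cong (λ z → suc (z + double p)) (halve≡inj₁⇒double _ eq))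
    ...       | inj₂ j =
      vD j (suc-double<double⇒< (ℕP.+-cancelʳ-< (double p) (suc (double j)) (double q) (ℕP.≤-pred (subst (_< L) d≡ lt)))) d≡
      where d≡ = trans (shift-X (beyond-X ¬lt ¬eq)) (cong (λ z → suc (z + double p)) (halve≡inj₂⇒suc-double _ eq))
    view d ≢none | no ¬lt | no ¬eq | no _ with d ℕP.≟ s
    ...       | yes eq = vS eq
    ...       | no _ = ⊥-elim (≢none refl)

    classify≡none⇒ : ∀ d → classify d ≡ none → L ≤ d × d ≢ s
    classify≡none⇒ d eq with d ℕP.<? double p
    ... | yes _ = ⊥-elim (E/O≢none (halve d) eq)
      where
        E/O≢none : ∀ x → [ E , O ] x ≢ none
        E/O≢none (inj₁ _) ()
        E/O≢none (inj₂ _) ()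
    ... | no _ with d ℕP.≟ double p
    ...   | yes _ = ⊥-elim (X≢none eq)
      where
        X≢none : X ≢ none
        X≢none ()
    ...   | no _ with d ℕP.<? L
    ...     | yes _ = ⊥-elim (C/D≢none (halve (d ∸ suc (double p))) eq)
      where
        C/D≢none : ∀ x → [ C , D ] x ≢ none
        C/D≢none (inj₁ _) ()
        C/D≢none (inj₂ _) ()
    ...     | no ¬lt with d ℕP.≟ s
    ...       | yes _ = ⊥-elim (S≢none eq)
      where
        S≢none : S ≢ none
        S≢none ()
    ...       | no ¬eq = ℕP.≮⇒≥ ¬lt , ¬eq

    filled⇒below-L-or-S : ∀ d → classify d ≢ none → d < L ⊎ d ≡ s
    filled⇒below-L-or-S d ≢none with view d ≢none
    ... | vE k k<p refl = inj₁ (ℕP.<-≤-trans (double-mono-< k<p) 2p≤L)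
    ... | vO k k<p refl = inj₁ (ℕP.<-≤-trans (double-mono-≤ k<p) 2p≤L)
    ... | vX refl       = inj₁ (s≤s (2p≤2p+2j q))
    ... | vC j j<q refl = inj₁ (s≤s (ℕP.+-monoˡ-< (double p) (double-mono-< j<q)))
    ... | vD j j<q refl = inj₁ (s≤s (ℕP.+-monoˡ-< (double p) (double-mono-≤ j<q)))
    ... | vS eq         = inj₂ eq

    below-L-or-S⇒filled : ∀ d → d < L ⊎ d ≡ s → classify d ≢ none
    below-L-or-S⇒filled d (inj₁ d<L) eq = ℕP.<-irrefl refl (ℕP.<-≤-trans d<L (proj₁ (classify≡none⇒ d eq)))
    below-L-or-S⇒filled d (inj₂ d≡s) eq = proj₂ (classify≡none⇒ d eq) d≡s

module LinePrefixes (n q G : ℕ) (F₁ F₂ : ℕ → ℤ) (δ κ κ′ : ℤ) where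

  open import Data.Nat as ℕ using (zero; suc; z≤n; _<_; _+_)
  import Data.Nat.Properties as ℕP
  open import Data.Integer as ℤ using (ℤ; +_; _-_)
  import Data.Integer.Properties as ℤP
  open import Data.Integer.Divisibility using (_∣_)
  open import Data.Empty using (⊥-elim)
  open import Relation.Binary.PropositionalEquality
  open import Relation.Nullary using (¬_; yes; no)
  open Doubling using (double)
  open Profile
  open Shape n q G F₁ F₂ δ κ κ′
  open Spread
  open Diagonals

  module _ {w : ℕ → ℤ} {s : ℕ} (fits : Fits w s) where
    open Fits fits
    open Layout q s using (classify; View; vE; vO; vX; vC; vD; vS; view)

    rowTag : ∀ {d} → View d → Tag
    rowTag (vE k _ _) = tE k
    rowTag (vO k _ _) = tO k
    rowTag (vX _)     = tE p
    rowTag (vC j _ _) = tC j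
    rowTag (vD j _ _) = tD j
    rowTag (vS _)     = tC q

    colTag : ∀ {d} → View d → Tag
    colTag (vE k _ _) = tO k
    colTag (vO k _ _) = tE (suc k)
    colTag (vX _)     = tC 0
    colTag (vC j _ _) = tD j
    colTag (vD j _ _) = tC (suc j)
    colTag (vS _)     = tE 0

    rowTag-valid : ∀ {d} (v : View d) → Valid q (rowTag v)
    rowTag-valid (vE k k<p _) = ℕP.<⇒≤ k<p
    rowTag-valid (vO k k<p _) = k<p
    rowTag-valid (vX _)       = ℕP.≤-refl
    rowTag-valid (vC j j<q _) = ℕP.<⇒≤ j<q
    rowTag-valid (vD j j<q _) = j<q
    rowTag-valid (vS _)       = ℕP.≤-refl

    colTag-valid : ∀ {d} (v : View d) → Valid q (colTag v)
    colTag-valid (vE k k<p _) = k<p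
    colTag-valid (vO k k<p _) = k<p
    colTag-valid (vX _)       = z≤n
    colTag-valid (vC j j<q _) = j<q
    colTag-valid (vD j j<q _) = j<q
    colTag-valid (vS _)       = z≤n

    rowUntag : Tag → ℕ
    rowUntag (tE k) = double k
    rowUntag (tO k) = suc (double k)
    rowUntag (tC j) with j ℕP.≟ q
    ... | yes _ = s
    ... | no  _ = suc (double j + double p)
    rowUntag (tD j) = suc (suc (double j + double p))

    colUntag : Tag → ℕ
    colUntag (tE zero)    = s
    colUntag (tE (suc k)) = suc (double k)
    colUntag (tO k)       = double k
    colUntag (tC zero)    = double p
    colUntag (tC (suc j)) = suc (suc (double j + double p))
    colUntag (tD j)       = suc (double j + double p)

    rowUntag-rowTag : ∀ {d} (v : View d) → rowUntag (rowTag v) ≡ d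
    rowUntag-rowTag (vE k _ e) = sym e
    rowUntag-rowTag (vO k _ e) = sym e
    rowUntag-rowTag (vX e)     = sym e
    rowUntag-rowTag (vC j j<q e) with j ℕP.≟ q
    ... | yes refl = ⊥-elim (ℕP.<-irrefl refl j<q)
    ... | no  _    = sym e
    rowUntag-rowTag (vD j _ e) = sym e
    rowUntag-rowTag (vS e) with q ℕP.≟ q
    ... | yes _ = sym e
    ... | no ¬eq = ⊥-elim (¬eq refl)

    colUntag-colTag : ∀ {d} (v : View d) → colUntag (colTag v) ≡ d
    colUntag-colTag (vE k _ e) = sym e
    colUntag-colTag (vO k _ e) = sym e
    colUntag-colTag (vX e)     = sym e
    colUntag-colTag (vC j _ e) = sym e
    colUntag-colTag (vD j _ e) = sym e
    colUntag-colTag (vS e)     = sym e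

    module _ (sorted : Sorted q beforeE beforeO beforeC beforeD lo hi) (M : ℕ) (width<M : hi - lo ℤ.< + M) where

      prefix-rowTag : ∀ {d} (v : View d) → prefix w d ≡ value sorted (rowTag v)
      prefix-rowTag (vE k k<p refl) = prefix-E fits k (ℕP.<⇒≤ k<p)
      prefix-rowTag (vO k k<p refl) = prefix-O fits k k<p
      prefix-rowTag (vX refl)       = prefix-E fits p ℕP.≤-refl
      prefix-rowTag (vC j j<q refl) = prefix-C fits j (ℕP.<⇒≤ j<q)
      prefix-rowTag (vD j j<q refl) = prefix-D fits j j<q
      prefix-rowTag (vS refl)       = prefix-gap fits s L≤s ℕP.≤-refl

      prefix-colTag : κ - κ′ ≡ δ → ∀ {d} (v : View d) → prefix w (suc d) ≡ value sorted (colTag v)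
      prefix-colTag _        (vE k k<p refl) = prefix-O fits k k<p
      prefix-colTag _        (vO k k<p refl) = prefix-E fits (suc k) k<p
      prefix-colTag _        (vX refl)       = prefix-C fits 0 z≤n
      prefix-colTag _        (vC j j<q refl) = prefix-D fits j j<q
      prefix-colTag _        (vD j j<q refl) = prefix-C fits (suc j) j<q
      prefix-colTag balanced (vS refl)       = trans (prefix-after-S fits balanced) (sym (ℤP.*-zeroˡ (N - δ)))

      row-prefixes-distinct : ∀ d d′ → (f : classify d ≢ none) (f′ : classify d′ ≢ none) → d ≢ d′ →
                              ¬ ((+ M) ∣ (prefix w d - prefix w d′))
      row-prefixes-distinct d d′ f f′ d≢d′ M∣ =
        values-distinct-mod sorted M width<M (rowTag v) (rowTag v′) (rowTag-valid v) (rowTag-valid v′)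
          (λ eq → d≢d′ (trans (sym (rowUntag-rowTag v)) (trans (cong rowUntag eq) (rowUntag-rowTag v′))))
          (subst ((+ M) ∣_) (cong₂ _-_ (prefix-rowTag v) (prefix-rowTag v′)) M∣)
        where
          v = view d f
          v′ = view d′ f′

      col-prefixes-distinct : κ - κ′ ≡ δ → ∀ d d′ → (f : classify d ≢ none) (f′ : classify d′ ≢ none) → d ≢ d′ →
                              ¬ ((+ M) ∣ (prefix w (suc d) - prefix w (suc d′)))
      col-prefixes-distinct balanced d d′ f f′ d≢d′ M∣ =
        values-distinct-mod sorted M width<M (colTag v) (colTag v′) (colTag-valid v) (colTag-valid v′)
          (λ eq → d≢d′ (trans (sym (colUntag-colTag v)) (trans (cong colUntag eq) (colUntag-colTag v′))))
          (subst ((+ M) ∣_) (cong₂ _-_ (prefix-colTag balanced v) (prefix-colTag balanced v′)) M∣)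
        where
          v = view d f
          v′ = view d′ f′

module Cells (n : ℕ) {{_ : NonZero n}} where

  open import Data.Nat as ℕ using (zero; suc; z≤n; s≤s; _≤_; _<_; _+_; _∸_)
  import Data.Nat.Properties as ℕP
  open import Data.Nat.DivMod
  open import Data.Integer as ℤ using (0ℤ; _-_)
  open import Relation.Binary.PropositionalEquality
  open import Relation.Nullary using (yes; no)
  open import Data.Sum using (inj₁; inj₂)
  open import Data.Integer.Tactic.RingSolver
  open Profile using (prefix)
  open Congruence n

  diag : ℕ → ℕ → ℕ
  diag r c = (r + (n ∸ c)) % n

  diag<n : ∀ r c → diag r c < n
  diag<n r c = m%n<n (r + (n ∸ c)) n

  diag-≤ : ∀ {r c} → c ≤ r → r < n → diag r c ≡ r ∸ c
  diag-≤ {r} {c} c≤r r<n =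
    trans (cong (_% n) r+[n∸c]≡[r∸c]+n)
          (trans ([m+n]%n≡m%n (r ∸ c) n) (m<n⇒m%n≡m (ℕP.≤-<-trans (ℕP.m∸n≤m r c) r<n)))
    where
      r+[n∸c]≡[r∸c]+n : r + (n ∸ c) ≡ (r ∸ c) + n
      r+[n∸c]≡[r∸c]+n = trans (cong (_+ (n ∸ c)) (sym (ℕP.m∸n+n≡m c≤r)))
        (trans (ℕP.+-assoc (r ∸ c) c (n ∸ c)) (cong ((r ∸ c) +_) (ℕP.m+[n∸m]≡n (ℕP.≤-trans c≤r (ℕP.<⇒≤ r<n)))))

  diag-> : ∀ {r c} → r < c → c ≤ n → diag r c ≡ r + (n ∸ c)
  diag-> {r} {c} r<c c≤n = m<n⇒m%n≡m (subst (r + (n ∸ c) <_) (ℕP.m+[n∸m]≡n c≤n) (ℕP.+-monoˡ-< (n ∸ c) r<c))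

  diag-involutive : ∀ r c → c < n → diag r (diag r c) ≡ c
  diag-involutive r c c<n =
    trans (≋-cancelʳ {r + (n ∸ d)} {c} d
            (≋-trans (≡⇒≋ e₁) (≋-trans (≡⇒≋ (sym e₂)) (≋-+ (≋-refl {c}) (≋-sym (%-≋ (r + (n ∸ c))))))))
          (m<n⇒m%n≡m c<n)
    where
      d = diag r c
      e₁ : r + (n ∸ d) + d ≡ r + n
      e₁ = trans (ℕP.+-assoc r (n ∸ d) d) (cong (r +_) (ℕP.m∸n+n≡m (ℕP.<⇒≤ (diag<n r c))))
      e₂ : c + (r + (n ∸ c)) ≡ r + n
      e₂ = trans (sym (ℕP.+-assoc c r (n ∸ c))) (trans (cong (_+ (n ∸ c)) (ℕP.+-comm c r))
             (trans (ℕP.+-assoc r c (n ∸ c)) (cong (r +_) (ℕP.m+[n∸m]≡n (ℕP.<⇒≤ c<n)))))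

  diag+d≋r : ∀ r {d} → d ≤ n → diag r d + d ≋ r
  diag+d≋r r {d} d≤n =
    ≋-trans (≋-+ (%-≋ (r + (n ∸ d))) (≋-refl {d}))
      (≋-trans (≡⇒≋ (trans (ℕP.+-assoc r (n ∸ d) d) (cong (r +_) (ℕP.m∸n+n≡m d≤n)))) (+n-≋ r))

  diag-injectiveˡ : ∀ c {i j} → i < n → j < n → diag i c ≡ diag j c → i ≡ j
  diag-injectiveˡ c i<n j<n e = ≋⇒≡ (≋-cancelʳ (n ∸ c) e) i<n j<n

  private
    ∸-suc : ∀ r c → suc c ≤ r → r ∸ c ≡ suc (r ∸ suc c)
    ∸-suc (suc r) c (s≤s c≤r) = ℕP.+-∸-assoc 1 c≤r

    n≡1+[n∸1] : n ≡ suc (n ∸ 1)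
    n≡1+[n∸1] = sym (trans (ℕP.+-comm 1 (n ∸ 1)) (ℕP.m∸n+n≡m (ℕ.>-nonZero⁻¹ n)))

    n∸1<n : n ∸ 1 < n
    n∸1<n = subst (n ∸ 1 <_) (sym n≡1+[n∸1]) (ℕP.n<1+n (n ∸ 1))

    0+b≡[a+b]-a : ∀ a b → 0ℤ ℤ.+ b ≡ (a ℤ.+ b) - a
    0+b≡[a+b]-a = solve-∀

  module LineSums (w : ℕ → ℤ) where

    rowSum : ℕ → ℕ → ℤ
    rowSum r zero    = 0ℤ
    rowSum r (suc c) = rowSum r c ℤ.+ w (diag r c)

    colSum : ℕ → ℕ → ℤ
    colSum c zero    = 0ℤ
    colSum c (suc r) = colSum c r ℤ.+ w (diag r c)

    private
      U = prefix w

    -- Row r meets the diagonals r, r-1, …, 0, n-1, …, r+1 in this order and column c meets them in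
    -- increasing cyclic order from n-c; hence the closed forms rowSum-closed and colSum-closed.
    rowSum-≤ : ∀ {r} → r < n → ∀ c → c ≤ r → rowSum r (suc c) ≡ U (suc r) - U (r ∸ c)
    rowSum-≤ {r} r<n zero _ = trans (cong (λ z → 0ℤ ℤ.+ w z) (diag-≤ z≤n r<n)) (0+b≡[a+b]-a (U r) (w r))
    rowSum-≤ {r} r<n (suc c) c<r =
      trans (cong₂ ℤ._+_ (rowSum-≤ r<n c (ℕP.<⇒≤ c<r)) (cong w (diag-≤ c<r r<n)))
        (trans (cong (λ z → U (suc r) - U z ℤ.+ w (r ∸ suc c)) (∸-suc r c c<r))
               (lemma (U (suc r)) (U (r ∸ suc c)) (w (r ∸ suc c))))
      where
        lemma : ∀ A x y → A - (x ℤ.+ y) ℤ.+ y ≡ A - x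
        lemma = solve-∀

    rowSum-> : ∀ {r} → r < n → ∀ c → r < c → c < n → rowSum r (suc c) ≡ U (suc r) ℤ.+ U n - U (r + (n ∸ c))
    rowSum-> {r} r<n (suc c) (s≤s r≤c) c<n with r ℕP.≟ c
    ... | yes refl =
      trans (cong₂ ℤ._+_ (rowSum-≤ r<n r ℕP.≤-refl) (cong w (diag-> (ℕP.n<1+n r) (ℕP.<⇒≤ c<n))))
        (trans (cong (λ z → U (suc r) - U z ℤ.+ w x) (ℕP.n∸n≡0 r))
          (trans (lemma (U (suc r)) (U x) (w x)) (cong (λ z → U (suc r) ℤ.+ z - U x) (sym (cong U n≡1+x)))))
      where
        x = r + (n ∸ suc r)
        n≡1+x : n ≡ suc x
        n≡1+x = sym (ℕP.m+[n∸m]≡n (ℕP.<⇒≤ c<n))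
        lemma : ∀ A x y → A - 0ℤ ℤ.+ y ≡ A ℤ.+ (x ℤ.+ y) - x
        lemma = solve-∀
    ... | no r≢c =
      trans (cong₂ ℤ._+_ (rowSum-> r<n c r<c (ℕP.<-trans (ℕP.n<1+n c) c<n))
                         (cong w (diag-> (ℕP.<-trans r<c (ℕP.n<1+n c)) (ℕP.<⇒≤ c<n))))
        (trans (cong (λ z → U (suc r) ℤ.+ U n - U (r + z) ℤ.+ w x) (∸-suc n c (ℕP.<⇒≤ c<n)))
          (trans (cong (λ z → U (suc r) ℤ.+ U n - U z ℤ.+ w x) (ℕP.+-suc r (n ∸ suc c)))
            (lemma (U (suc r)) (U n) (U x) (w x))))
      where
        r<c = ℕP.≤∧≢⇒< r≤c r≢c
        x = r + (n ∸ suc c)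
        lemma : ∀ A B x y → A ℤ.+ B - (x ℤ.+ y) ℤ.+ y ≡ A ℤ.+ B - x
        lemma = solve-∀

    rowSum-closed : U n ≡ 0ℤ → ∀ {r} → r < n → ∀ c → c < n → rowSum r (suc c) ≡ U (suc r) - U (diag r c)
    rowSum-closed Un≡0 {r} r<n c c<n with ℕP.≤-<-connex c r
    ... | inj₁ c≤r = trans (rowSum-≤ r<n c c≤r) (cong (λ x → U (suc r) - U x) (sym (diag-≤ c≤r r<n)))
    ... | inj₂ r<c =
      trans (rowSum-> r<n c r<c c<n)
        (trans (cong (λ x → U (suc r) ℤ.+ x - U (r + (n ∸ c))) Un≡0)
          (trans (ℤ+0-x (U (suc r)) (U (r + (n ∸ c)))) (cong (λ x → U (suc r) - U x) (sym (diag-> r<c (ℕP.<⇒≤ c<n))))))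
      where
        ℤ+0-x : ∀ A x → A ℤ.+ 0ℤ - x ≡ A - x
        ℤ+0-x = solve-∀

    rowSum-total : ∀ {r} → r < n → rowSum r n ≡ U n
    rowSum-total {r} r<n = subst (λ m → rowSum r m ≡ U n) (sym n≡1+[n∸1]) last
      where
        c = n ∸ 1
        last : rowSum r (suc c) ≡ U n
        last with ℕP.≤-<-connex c r
        ... | inj₁ c≤r with ℕP.≤-antisym c≤r (ℕP.≤-pred (subst (r <_) n≡1+[n∸1] r<n))
        ...   | refl = trans (rowSum-≤ r<n r ℕP.≤-refl)
                         (trans (cong (λ x → U (suc r) - U x) (ℕP.n∸n≡0 r))
                           (trans (A-0≡A (U (suc r))) (cong U (sym n≡1+[n∸1]))))
          where
            A-0≡A : ∀ A → A - 0ℤ ≡ A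
            A-0≡A = solve-∀
        last | inj₂ r<c = trans (rowSum-> r<n c r<c n∸1<n)
                            (trans (cong (λ x → U (suc r) ℤ.+ U n - U x) r+[n∸c]≡1+r) (A+B-A≡B (U (suc r)) (U n)))
          where
            r+[n∸c]≡1+r : r + (n ∸ c) ≡ suc r
            r+[n∸c]≡1+r = trans (cong (r +_) (trans (cong (_∸ c) n≡1+[n∸1]) (ℕP.m+n∸n≡m 1 c))) (ℕP.+-comm r 1)
            A+B-A≡B : ∀ A B → A ℤ.+ B - A ≡ B
            A+B-A≡B = solve-∀

    colSum-< : ∀ c → c ≤ n → ∀ r → r < c → colSum c (suc r) ≡ U (suc (r + (n ∸ c))) - U (n ∸ c)
    colSum-< c c≤n zero    0<c = trans (cong (λ z → 0ℤ ℤ.+ w z) (diag-> 0<c c≤n)) (0+b≡[a+b]-a (U (n ∸ c)) (w (n ∸ c)))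
    colSum-< c c≤n (suc r) r<c =
      trans (cong₂ ℤ._+_ (colSum-< c c≤n r (ℕP.<-trans (ℕP.n<1+n r) r<c)) (cong w (diag-> r<c c≤n)))
            (lemma (U (suc (r + (n ∸ c)))) (U (n ∸ c)) (w (suc (r + (n ∸ c)))))
      where
        lemma : ∀ a x y → a - x ℤ.+ y ≡ (a ℤ.+ y) - x
        lemma = solve-∀

    colSum-≥ : ∀ c → c < n → ∀ r → c ≤ r → r < n → colSum c (suc r) ≡ U n - U (n ∸ c) ℤ.+ U (suc (r ∸ c))
    colSum-≥ zero c<n zero _ r<n = trans (cong (λ z → 0ℤ ℤ.+ w z) (diag-≤ z≤n r<n)) (lemma (U n) (w 0))
      where
        lemma : ∀ A y → 0ℤ ℤ.+ y ≡ A - A ℤ.+ (0ℤ ℤ.+ y)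
        lemma = solve-∀
    colSum-≥ c c<n (suc r) c≤1+r r<n with c ℕP.≤? r
    ... | yes c≤r =
      trans (cong₂ ℤ._+_ (colSum-≥ c c<n r c≤r (ℕP.<-trans (ℕP.n<1+n r) r<n))
                         (cong w (trans (diag-≤ c≤1+r r<n) (ℕP.+-∸-assoc 1 c≤r))))
        (trans (lemma (U n) (U (n ∸ c)) (U (suc (r ∸ c))) (w (suc (r ∸ c))))
          (cong (λ z → U n - U (n ∸ c) ℤ.+ U (suc z)) (sym (ℕP.+-∸-assoc 1 c≤r))))
      where
        lemma : ∀ A X u y → A - X ℤ.+ u ℤ.+ y ≡ A - X ℤ.+ (u ℤ.+ y)
        lemma = solve-∀
    ... | no c≰r with ℕP.≤-antisym c≤1+r (ℕP.≰⇒> c≰r)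
    ...   | refl =
      trans (cong₂ ℤ._+_ (colSum-< c (ℕP.<⇒≤ c<n) r (ℕP.n<1+n r))
                         (cong w (trans (diag-≤ ℕP.≤-refl r<n) (ℕP.n∸n≡0 (suc r)))))
        (trans (cong (λ z → U z - U (n ∸ suc r) ℤ.+ w 0) (ℕP.m+[n∸m]≡n (ℕP.<⇒≤ c<n)))
          (trans (lemma (U n) (U (n ∸ suc r)) (w 0))
            (cong (λ z → U n - U (n ∸ suc r) ℤ.+ U (suc z)) (sym (ℕP.n∸n≡0 (suc r))))))
      where
        lemma : ∀ A X y → A - X ℤ.+ y ≡ A - X ℤ.+ (0ℤ ℤ.+ y)
        lemma = solve-∀

    colSum-closed : U n ≡ 0ℤ → ∀ c → c < n → ∀ r → r < n → colSum c (suc r) ≡ U (suc (diag r c)) - U (n ∸ c)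
    colSum-closed Un≡0 c c<n r r<n with ℕP.≤-<-connex c r
    ... | inj₁ c≤r =
      trans (colSum-≥ c c<n r c≤r r<n)
        (trans (cong (λ x → x - U (n ∸ c) ℤ.+ U (suc (r ∸ c))) Un≡0)
          (trans (lemma (U (n ∸ c)) (U (suc (r ∸ c)))) (cong (λ x → U (suc x) - U (n ∸ c)) (sym (diag-≤ c≤r r<n)))))
      where
        lemma : ∀ X u → 0ℤ - X ℤ.+ u ≡ u - X
        lemma = solve-∀
    ... | inj₂ r<c = trans (colSum-< c (ℕP.<⇒≤ c<n) r r<c)
                           (cong (λ x → U (suc x) - U (n ∸ c)) (sym (diag-> r<c (ℕP.<⇒≤ c<n))))

    colSum-total : ∀ c → c < n → colSum c n ≡ U n
    colSum-total c c<n = subst (λ m → colSum c m ≡ U n) (sym n≡1+[n∸1])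
      (trans (colSum-≥ c c<n (n ∸ 1) c≤n∸1 n∸1<n)
        (trans (cong (λ x → U n - U (n ∸ c) ℤ.+ U x) 1+[n∸1∸c]≡n∸c) (A-X+X≡A (U n) (U (n ∸ c)))))
      where
        c≤n∸1 : c ≤ n ∸ 1
        c≤n∸1 = ℕP.≤-pred (subst (c <_) n≡1+[n∸1] c<n)
        1+[n∸1∸c]≡n∸c : suc ((n ∸ 1) ∸ c) ≡ n ∸ c
        1+[n∸1∸c]≡n∸c = trans (sym (ℕP.+-∸-assoc 1 c≤n∸1)) (cong (_∸ c) (sym n≡1+[n∸1]))
        A-X+X≡A : ∀ A X → A - X ℤ.+ X ≡ A
        A-X+X≡A = solve-∀

module Traversal where

  open import Data.Nat as ℕ using (zero; suc; z≤n; s≤s)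
  open import Data.Integer as ℤ using (+_; _+_; _-_; 0ℤ; 1ℤ)
  import Data.Integer.Properties as ℤP
  open import Data.Integer.Divisibility using (_∣_)
  open import Data.Fin using (Fin; zero; suc; toℕ)
  open import Data.List using (mapMaybe; tabulate; length)
  open import Data.List.Relation.Unary.All as All using (All; []; _∷_)
  import Data.List.Relation.Unary.All.Properties as All
  open import Data.List.Relation.Unary.AllPairs as AllPairs using (AllPairs; []; _∷_)
  import Data.List.Relation.Unary.AllPairs.Properties as AllPairs
  open import Data.Maybe using (Maybe; just; nothing; fromMaybe)
  open import Data.Product using (Σ; ∃; _×_; _,_)
  open import Relation.Binary.PropositionalEquality
  open import Relation.Nullary using (¬_)
  open import Data.Integer.Tactic.RingSolver
  open import Defs using (sumℤ; partialSums; DistinctMod)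

  mark : Maybe ℤ → ℤ
  mark (just _) = 1ℤ
  mark nothing  = 0ℤ

  private
    y+[a-[b+y]]≡a-b : ∀ y a b → y + (a - (b + y)) ≡ a - b
    y+[a-[b+y]]≡a-b = solve-∀
    a-[b+0]≡a-b : ∀ a b → a - (b + 0ℤ) ≡ a - b
    a-[b+0]≡a-b = solve-∀
    y≡[a+y]-a : ∀ a y → y ≡ (a + y) - a
    y≡[a+y]-a = solve-∀

  module _ {X : Set} (f : X → Maybe ℤ) where

    Occupied : X → Set
    Occupied x = ∃ λ y → f x ≡ just y

    Telescopes : ∀ {n} → (Fin n → X) → (Maybe ℤ → ℤ) → (ℕ → ℤ) → Set
    Telescopes {n} g weight P = ∀ (i : Fin n) → P (suc (toℕ i)) ≡ P (toℕ i) + weight (f (g i))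

    private
      first-step : ∀ {n} (g : Fin (suc n) → X) weight P → Telescopes g weight P →
                   ∀ {m} → f (g zero) ≡ m → P 1 ≡ P 0 + weight m
      first-step g weight P tel eq = trans (tel zero) (cong (λ m → P 0 + weight m) eq)

    sum-telescopes : ∀ n (g : Fin n → X) (P : ℕ → ℤ) → Telescopes g (fromMaybe 0ℤ) P →
                     sumℤ (mapMaybe f (tabulate g)) ≡ P n - P 0
    sum-telescopes zero    g P tel = sym (ℤP.+-inverseʳ (P 0))
    sum-telescopes (suc n) g P tel with f (g zero) in eq
                                   | sum-telescopes n (λ i → g (suc i)) (λ k → P (suc k)) (λ i → tel (suc i))
    ... | just y  | ih = trans (cong (λ z → y + z) ih)
                           (trans (cong (λ z → y + (P (suc n) - z)) (first-step g (fromMaybe 0ℤ) P tel eq))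
                                  (y+[a-[b+y]]≡a-b y (P (suc n)) (P 0)))
    ... | nothing | ih = trans ih (trans (cong (λ z → P (suc n) - z) (first-step g (fromMaybe 0ℤ) P tel eq))
                                         (a-[b+0]≡a-b (P (suc n)) (P 0)))

    length-telescopes : ∀ n (g : Fin n → X) (P : ℕ → ℤ) → Telescopes g mark P →
                        + length (mapMaybe f (tabulate g)) ≡ P n - P 0
    length-telescopes zero    g P tel = sym (ℤP.+-inverseʳ (P 0))
    length-telescopes (suc n) g P tel with f (g zero) in eq
                                      | length-telescopes n (λ i → g (suc i)) (λ k → P (suc k)) (λ i → tel (suc i))
    ... | just y  | ih = trans (ℤP.pos-+ 1 _) (trans (cong (λ z → 1ℤ + z) ih)
                           (trans (cong (λ z → 1ℤ + (P (suc n) - z)) (first-step g mark P tel eq))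
                                  (y+[a-[b+y]]≡a-b 1ℤ (P (suc n)) (P 0))))
    ... | nothing | ih = trans ih (trans (cong (λ z → P (suc n) - z) (first-step g mark P tel eq)) (a-[b+0]≡a-b (P (suc n)) (P 0)))

    private
      Reached : ∀ {n} → (Fin n → X) → (ℕ → ℤ) → ℤ → Set
      Reached {n} g P y = Σ (Fin n) λ j → Occupied (g j) × y ≡ P (suc (toℕ j)) - P 0

      ReachedInOrder : ∀ {n} → (Fin n → X) → (ℕ → ℤ) → ℤ → ℤ → Set
      ReachedInOrder {n} g P y z = Σ (Fin n) λ i → Σ (Fin n) λ j → toℕ i ℕ.< toℕ j × Occupied (g i) × Occupied (g j) ×
                                   y ≡ P (suc (toℕ i)) - P 0 × z ≡ P (suc (toℕ j)) - P 0

      shift : ∀ (P : ℕ → ℤ) (y : ℤ) → P 1 ≡ P 0 + y → ∀ m {v} → v ≡ P (suc m) - P 1 → y + v ≡ P (suc m) - P 0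
      shift P y P₁ m ev = trans (cong (λ z → y + z) ev)
        (trans (cong (λ z → y + (P (suc m) - z)) P₁) (y+[a-[b+y]]≡a-b y (P (suc m)) (P 0)))

      partialSums-reached : ∀ n (g : Fin n → X) (P : ℕ → ℤ) → Telescopes g (fromMaybe 0ℤ) P →
                            All (Reached g P) (partialSums (mapMaybe f (tabulate g)))
      partialSums-reached zero    g P tel = []
      partialSums-reached (suc n) g P tel with f (g zero) in eq
                                          | partialSums-reached n (λ i → g (suc i)) (λ k → P (suc k)) (λ i → tel (suc i))
      ... | just y  | ih = (zero , (y , eq) , trans (y≡[a+y]-a (P 0) y) (cong (_- P 0) (sym P₁))) ∷ All.map⁺ (All.map step ih)
        where
          P₁ = first-step g (fromMaybe 0ℤ) P tel eq
          step : ∀ {v} → Reached (λ i → g (suc i)) (λ k → P (suc k)) v → Reached g P (y + v)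
          step (j , filled , ev) = suc j , filled , shift P y P₁ (suc (toℕ j)) ev
      ... | nothing | ih = All.map step ih
        where
          P₁ = first-step g (fromMaybe 0ℤ) P tel eq
          step : ∀ {v} → Reached (λ i → g (suc i)) (λ k → P (suc k)) v → Reached g P v
          step (j , filled , ev) = suc j , filled , trans (sym (ℤP.+-identityˡ _)) (shift P 0ℤ P₁ (suc (toℕ j)) ev)

      partialSums-reachedInOrder : ∀ n (g : Fin n → X) (P : ℕ → ℤ) → Telescopes g (fromMaybe 0ℤ) P →
                                   AllPairs (ReachedInOrder g P) (partialSums (mapMaybe f (tabulate g)))
      partialSums-reachedInOrder zero    g P tel = []
      partialSums-reachedInOrder (suc n) g P tel with f (g zero) in eq
        | partialSums-reached n (λ i → g (suc i)) (λ k → P (suc k)) (λ i → tel (suc i))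
        | partialSums-reachedInOrder n (λ i → g (suc i)) (λ k → P (suc k)) (λ i → tel (suc i))
      ... | just y  | all | pairs = All.map⁺ (All.map head all) ∷ AllPairs.map⁺ (AllPairs.map tail pairs)
        where
          P₁ = first-step g (fromMaybe 0ℤ) P tel eq
          head : ∀ {v} → Reached (λ i → g (suc i)) (λ k → P (suc k)) v → ReachedInOrder g P y (y + v)
          head (j , filled , ev) = zero , suc j , s≤s z≤n , (y , eq) , filled ,
                                   trans (y≡[a+y]-a (P 0) y) (cong (_- P 0) (sym P₁)) , shift P y P₁ (suc (toℕ j)) ev
          tail : ∀ {u v} → ReachedInOrder (λ i → g (suc i)) (λ k → P (suc k)) u v → ReachedInOrder g P (y + u) (y + v)
          tail (i , j , i<j , fi , fj , eu , ev) =
            suc i , suc j , s≤s i<j , fi , fj , shift P y P₁ (suc (toℕ i)) eu , shift P y P₁ (suc (toℕ j)) ev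
      ... | nothing | _ | pairs = AllPairs.map tail pairs
        where
          P₁ = first-step g (fromMaybe 0ℤ) P tel eq
          shift₀ : ∀ m {v} → v ≡ P (suc m) - P 1 → v ≡ P (suc m) - P 0
          shift₀ m ev = trans (sym (ℤP.+-identityˡ _)) (shift P 0ℤ P₁ m ev)
          tail : ∀ {u v} → ReachedInOrder (λ i → g (suc i)) (λ k → P (suc k)) u v → ReachedInOrder g P u v
          tail (i , j , i<j , fi , fj , eu , ev) =
            suc i , suc j , s≤s i<j , fi , fj , shift₀ (suc (toℕ i)) eu , shift₀ (suc (toℕ j)) ev

    partialSums-distinctMod : ∀ n (g : Fin n → X) (P : ℕ → ℤ) → Telescopes g (fromMaybe 0ℤ) P → (M : ℕ) →
      (∀ (i j : Fin n) → toℕ i ℕ.< toℕ j → Occupied (g i) → Occupied (g j) →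
         ¬ ((+ M) ∣ (P (suc (toℕ i)) - P (suc (toℕ j))))) →
      DistinctMod M (partialSums (mapMaybe f (tabulate g)))
    partialSums-distinctMod n g P tel M apart = AllPairs.map distinct (partialSums-reachedInOrder n g P tel)
      where
        [a-c]-[b-c]≡a-b : ∀ a b c → (a - c) - (b - c) ≡ a - b
        [a-c]-[b-c]≡a-b = solve-∀
        distinct : ∀ {u v} → ReachedInOrder g P u v → ¬ ((+ M) ∣ (u - v))
        distinct (i , j , i<j , fi , fj , refl , refl)
          rewrite [a-c]-[b-c]≡a-b (P (suc (toℕ i))) (P (suc (toℕ j))) (P 0) = apart i j i<j fi fj

module ModularInverse (n : ℕ) {{_ : NonZero n}} (1<n : 1 ℕ.< n) where

  open import Data.Nat using (_+_; _*_; _∸_; z≤n; s≤s)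
  import Data.Nat.Properties as ℕP
  open import Data.Nat.DivMod
  open import Data.Nat.GCD using (gcd; gcd-GCD; GCD; module Bézout)
  open import Data.Product using (Σ; _,_)
  open import Relation.Binary.PropositionalEquality
  import Data.Nat.Tactic.RingSolver as NS
  open Congruence n

  inverse-mod : ∀ α → gcd n α ≡ 1 → Σ ℕ λ u → (α * u) % n ≡ 1
  inverse-mod α gcd≡1 with Bézout.identity (subst (GCD n α) gcd≡1 (gcd-GCD n α))
  ... | Bézout.-+ x y 1+xn≡yα =
    y , trans (cong (_% n) (trans (ℕP.*-comm α y) (sym 1+xn≡yα))) (trans ([m+kn]%n≡m%n 1 x n) (m<n⇒m%n≡m 1<n))
  ... | Bézout.+- x y 1+yα≡xn = y * (n ∸ 1) , trans αy[n-1]≋1 (m<n⇒m%n≡m 1<n)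
    where
      m = n ∸ 1
      m+1≡n : m + 1 ≡ n
      m+1≡n = ℕP.m∸n+n≡m (ℕP.<⇒≤ 1<n)
      n≋0 : n ≋ 0
      n≋0 = trans (n%n≡0 n) (sym (m<n⇒m%n≡m (ℕP.<-trans (s≤s z≤n) 1<n)))
      yα+1≋0 : y * α + 1 ≋ 0
      yα+1≋0 = trans (cong (_% n) (trans (ℕP.+-comm (y * α) 1) 1+yα≡xn))
                     (trans (m*n%n≡0 x n) (sym (m<n⇒m%n≡m (ℕP.<-trans (s≤s z≤n) 1<n))))
      yα≋m : y * α ≋ m
      yα≋m = ≋-cancelʳ 1 (≋-trans yα+1≋0 (≋-trans (≋-sym n≋0) (≡⇒≋ (sym m+1≡n))))
      m*m≋1 : m * m ≋ 1
      m*m≋1 = ≋-cancelʳ m (≋-trans (≡⇒≋ (trans (lemma m) (cong (m *_) m+1≡n)))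
                (≋-trans (≋-* (≋-refl {m}) n≋0) (≋-trans (≡⇒≋ (ℕP.*-zeroʳ m))
                  (≋-trans (≋-sym n≋0) (≡⇒≋ (trans (sym m+1≡n) (ℕP.+-comm m 1)))))))
        where
          lemma : ∀ m → m * m + m ≡ m * (m + 1)
          lemma = NS.solve-∀
      αy[n-1]≋1 : α * (y * m) ≋ 1
      αy[n-1]≋1 = ≋-trans (≡⇒≋ (lemma α y m)) (≋-trans (≋-* yα≋m (≋-refl {m})) m*m≋1)
        where
          lemma : ∀ α y m → α * (y * m) ≡ y * α * m
          lemma = NS.solve-∀

module Construction (n q G α u : ℕ) {{_ : NonZero n}}
  (4p≤n : Doubling.double (suc q) ℕ.+ Doubling.double (suc q) ℕ.≤ n) (s<n : Doubling.double (suc q) ℕ.+ α ℕ.< n)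
  (2q<α : suc (Doubling.double q) ℕ.≤ α) (αu≡1 : (α ℕ.* u) % n ≡ 1) where

  open import Data.Nat as ℕ using (zero; suc; z≤n; s≤s; _≤_; _<_; _+_; _∸_; _*_)
  import Data.Nat.Properties as ℕP
  open import Data.Nat.DivMod
  open import Data.Integer as ℤ using (+_; 0ℤ; 1ℤ)
  import Data.Integer.Properties as ℤP
  open import Relation.Binary.PropositionalEquality
  open import Relation.Nullary using (yes; no; ¬_)
  open import Data.Empty using (⊥-elim)
  open import Data.Integer.Tactic.RingSolver
  import Data.Nat.Tactic.RingSolver as NS
  open import Data.Integer.Divisibility using (_∣_)
  open import Data.Product using (Σ; _×_; _,_; proj₁; proj₂)
  open import Data.Sum using (_⊎_; inj₁; inj₂)
  open import Data.Maybe using (Maybe; just; nothing; fromMaybe)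
  open import Data.Maybe.Properties using (just-injective)
  open import Data.Fin using (Fin; toℕ; fromℕ<)
  import Data.Fin.Properties as FinP
  open import Data.List using (length)
  open import Defs
    using (Array; Filled; InDiag; rowEntries; colEntries; sumℤ; partialSums; DistinctMod; IsSSHeffter; IsGloballySimple)
  open import Function.Bundles using (_⇔_; mk⇔; Equivalence)
  open import Function using (case_of_)
  open Traversal
  open Doubling
  open NonNegative
  open Profile using (prefix)
  open Diagonals

  p : ℕ
  p = suc q

  s : ℕ
  s = double p + α

  open Layout q s using (classify; L; classify-E; classify-O; classify-X; classify-C; classify-D; classify-S; classify-none)

  offsetEO : ℕ → ℕ → ℕ
  offsetEO k i = suc ((i + (n ∸ double p) + double k) % n)

  offsetCD : ℕ → ℕ → ℕ
  offsetCD j i = suc ((i + suc (double j)) % n)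

  inverse : ℕ → ℕ
  inverse i = (i * u) % n

  magnitude : ℕ → ℕ → ℕ
  magnitude b h = (G + b) * n + h

  -- Along a filled diagonal the offset takes each value 1, …, n once, so the diagonal of block b
  -- carries exactly the values (G+b)n+1, …, (G+b)n+n up to sign.
  entry : Diagonal → ℕ → ℤ
  entry (E k) i = ℤ.- (+ magnitude (double k) (offsetEO k i))
  entry (O k) i = + magnitude (suc (double k)) (offsetEO k i)
  entry X     i = ℤ.- (+ magnitude (suc (double p)) (n ∸ inverse i))
  entry (C j) i = + magnitude (suc (suc (double j + double p))) (offsetCD j i)
  entry (D j) i = ℤ.- (+ magnitude (suc (suc (suc (double j + double p)))) (offsetCD j i))
  entry S     i = + magnitude (double p) (n ∸ inverse i)
  entry none  i = 0ℤ

  inverse<n : ∀ i → inverse i < n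
  inverse<n i = m%n<n (i * u) n

  private
    g N P : ℤ
    g = + G
    N = + n
    P = + p

    pos-magnitude : ∀ b h → + magnitude b h ≡ (g ℤ.+ + b) ℤ.* N ℤ.+ + h
    pos-magnitude b h =
      trans (ℤP.pos-+ ((G + b) * n) h) (cong (ℤ._+ + h) (trans (ℤP.pos-* (G + b) n) (cong (ℤ._* N) (ℤP.pos-+ G b))))

    pos-∸ : ∀ {a b} → b ≤ a → + (a ∸ b) ≡ + a ℤ.- + b
    pos-∸ {a} {b} b≤a = sym (trans (ℤP.m-n≡m⊖n a b) (ℤP.⊖-≥ b≤a))

    pos-2j+2p : ∀ j → + (double j + double p) ≡ (+ j ℤ.+ + j) ℤ.+ (P ℤ.+ P)
    pos-2j+2p j = trans (ℤP.pos-+ (double j) (double p)) (cong₂ ℤ._+_ (pos-double j) (pos-double p))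

    pos-suc-then : ∀ {m} {z : ℤ} → + m ≡ z → + suc m ≡ 1ℤ ℤ.+ z
    pos-suc-then {m} e = trans (pos-suc m) (cong (λ z → 1ℤ ℤ.+ z) e)

  magnitude-E : ∀ k h → + magnitude (double k) h ≡ (g ℤ.+ + k ℤ.+ + k) ℤ.* N ℤ.+ + h
  magnitude-E k h = trans (pos-magnitude (double k) h)
    (trans (cong (λ z → (g ℤ.+ z) ℤ.* N ℤ.+ + h) (pos-double k)) (lemma g (+ k) N (+ h)))
    where
      lemma : ∀ g K N H → (g ℤ.+ (K ℤ.+ K)) ℤ.* N ℤ.+ H ≡ (g ℤ.+ K ℤ.+ K) ℤ.* N ℤ.+ H
      lemma = solve-∀

  magnitude-O : ∀ k h → + magnitude (suc (double k)) h ≡ (g ℤ.+ + k ℤ.+ + k ℤ.+ 1ℤ) ℤ.* N ℤ.+ + h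
  magnitude-O k h = trans (pos-magnitude (suc (double k)) h)
    (trans (cong (λ z → (g ℤ.+ z) ℤ.* N ℤ.+ + h) (pos-suc-then (pos-double k))) (lemma g (+ k) N (+ h)))
    where
      lemma : ∀ g K N H → (g ℤ.+ (1ℤ ℤ.+ (K ℤ.+ K))) ℤ.* N ℤ.+ H ≡ (g ℤ.+ K ℤ.+ K ℤ.+ 1ℤ) ℤ.* N ℤ.+ H
      lemma = solve-∀

  magnitude-X : ∀ κ → κ ≤ n → + magnitude (suc (double p)) (n ∸ κ) ≡ (g ℤ.+ P ℤ.+ P ℤ.+ + 2) ℤ.* N ℤ.- + κ
  magnitude-X κ κ≤n = trans (pos-magnitude (suc (double p)) (n ∸ κ))
    (trans (cong₂ (λ z w → (g ℤ.+ z) ℤ.* N ℤ.+ w) (pos-suc-then (pos-double p)) (pos-∸ κ≤n)) (lemma g P N (+ κ)))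
    where
      lemma : ∀ g P N K → (g ℤ.+ (1ℤ ℤ.+ (P ℤ.+ P))) ℤ.* N ℤ.+ (N ℤ.- K) ≡ (g ℤ.+ P ℤ.+ P ℤ.+ + 2) ℤ.* N ℤ.- K
      lemma = solve-∀

  magnitude-S : ∀ κ → κ ≤ n → + magnitude (double p) (n ∸ κ) ≡ (g ℤ.+ P ℤ.+ P ℤ.+ 1ℤ) ℤ.* N ℤ.- + κ
  magnitude-S κ κ≤n = trans (pos-magnitude (double p) (n ∸ κ))
    (trans (cong₂ (λ z w → (g ℤ.+ z) ℤ.* N ℤ.+ w) (pos-double p) (pos-∸ κ≤n)) (lemma g P N (+ κ)))
    where
      lemma : ∀ g P N K → (g ℤ.+ (P ℤ.+ P)) ℤ.* N ℤ.+ (N ℤ.- K) ≡ (g ℤ.+ P ℤ.+ P ℤ.+ 1ℤ) ℤ.* N ℤ.- K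
      lemma = solve-∀

  magnitude-C : ∀ j h → + magnitude (suc (suc (double j + double p))) h
                        ≡ (g ℤ.+ P ℤ.+ P ℤ.+ + 2 ℤ.+ + j ℤ.+ + j) ℤ.* N ℤ.+ + h
  magnitude-C j h = trans (pos-magnitude _ h)
    (trans (cong (λ z → (g ℤ.+ z) ℤ.* N ℤ.+ + h) (pos-suc-then (pos-suc-then (pos-2j+2p j)))) (lemma g P N (+ j) (+ h)))
    where
      lemma : ∀ g P N J H → (g ℤ.+ (1ℤ ℤ.+ (1ℤ ℤ.+ ((J ℤ.+ J) ℤ.+ (P ℤ.+ P))))) ℤ.* N ℤ.+ H
                            ≡ (g ℤ.+ P ℤ.+ P ℤ.+ + 2 ℤ.+ J ℤ.+ J) ℤ.* N ℤ.+ H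
      lemma = solve-∀

  magnitude-D : ∀ j h → + magnitude (suc (suc (suc (double j + double p)))) h
                        ≡ (g ℤ.+ P ℤ.+ P ℤ.+ + 3 ℤ.+ + j ℤ.+ + j) ℤ.* N ℤ.+ + h
  magnitude-D j h = trans (pos-magnitude _ h)
    (trans (cong (λ z → (g ℤ.+ z) ℤ.* N ℤ.+ + h) (pos-suc-then (pos-suc-then (pos-suc-then (pos-2j+2p j)))))
           (lemma g P N (+ j) (+ h)))
    where
      lemma : ∀ g P N J H → (g ℤ.+ (1ℤ ℤ.+ (1ℤ ℤ.+ (1ℤ ℤ.+ ((J ℤ.+ J) ℤ.+ (P ℤ.+ P)))))) ℤ.* N ℤ.+ H
                            ≡ (g ℤ.+ P ℤ.+ P ℤ.+ + 3 ℤ.+ J ℤ.+ J) ℤ.* N ℤ.+ H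
      lemma = solve-∀

  L≤s : L ≤ s
  L≤s = subst (_≤ s) (ℕP.+-comm (double p) (suc (double q))) (ℕP.+-monoʳ-≤ (double p) 2q<α)

  module LineFits (col : ℕ → ℕ) (F₁ F₂ : ℕ → ℤ) (δ κ κ′ : ℤ)
    (at-E : ∀ k → k < p → + offsetEO k (col (double k)) ≡ F₁ k)
    (at-O : ∀ k → k < p → + offsetEO k (col (suc (double k))) ≡ F₁ k ℤ.- δ)
    (at-X : + inverse (col (double p)) ≡ κ)
    (at-C : ∀ j → j < q → + offsetCD j (col (suc (double j + double p))) ≡ F₂ j)
    (at-D : ∀ j → j < q → + offsetCD j (col (suc (suc (double j + double p)))) ≡ F₂ j ℤ.- δ)
    (at-S : + inverse (col s) ≡ κ′) where

    open Profile
    open Shape n q G F₁ F₂ δ κ κ′ using (Fits)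

    line : ℕ → ℤ
    line d = entry (classify d) (col d)

    private
      X+[F-δ]≡X+F-δ : ∀ X F δ → X ℤ.+ (F ℤ.- δ) ≡ X ℤ.+ F ℤ.- δ
      X+[F-δ]≡X+F-δ = solve-∀
      -[X-K]≡-X+K : ∀ X K → ℤ.- (X ℤ.- K) ≡ ℤ.- X ℤ.+ K
      -[X-K]≡-X+K = solve-∀

      on : ∀ d {c : Diagonal} {v : ℤ} → classify d ≡ c → entry c (col d) ≡ v → line d ≡ v
      on d {v = v} eq = subst (λ c → entry c (col d) ≡ v) (sym eq)

    fits : Fits line s
    fits = record
      { at-E = λ k k<p → on (double k) (classify-E k k<p)
          (cong ℤ.-_ (trans (magnitude-E k _) (cong (λ z → (g ℤ.+ + k ℤ.+ + k) ℤ.* N ℤ.+ z) (at-E k k<p))))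
      ; at-O = λ k k<p → on (suc (double k)) (classify-O k k<p)
          (trans (magnitude-O k _) (trans (cong (λ z → (g ℤ.+ + k ℤ.+ + k ℤ.+ 1ℤ) ℤ.* N ℤ.+ z) (at-O k k<p))
                                          (X+[F-δ]≡X+F-δ ((g ℤ.+ + k ℤ.+ + k ℤ.+ 1ℤ) ℤ.* N) (F₁ k) δ)))
      ; at-X = on (double p) classify-X
          (trans (cong ℤ.-_ (magnitude-X _ (ℕP.<⇒≤ (inverse<n (col (double p))))))
            (trans (-[X-K]≡-X+K ((g ℤ.+ P ℤ.+ P ℤ.+ + 2) ℤ.* N) (+ inverse (col (double p))))
                   (cong (λ z → ℤ.- ((g ℤ.+ P ℤ.+ P ℤ.+ + 2) ℤ.* N) ℤ.+ z) at-X)))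
      ; at-C = λ j j<q → on _ (classify-C j j<q)
          (trans (magnitude-C j _) (cong (λ z → (g ℤ.+ P ℤ.+ P ℤ.+ + 2 ℤ.+ + j ℤ.+ + j) ℤ.* N ℤ.+ z) (at-C j j<q)))
      ; at-D = λ j j<q → on _ (classify-D j j<q)
          (cong ℤ.-_ (trans (magnitude-D j _)
            (trans (cong (λ z → (g ℤ.+ P ℤ.+ P ℤ.+ + 3 ℤ.+ + j ℤ.+ + j) ℤ.* N ℤ.+ z) (at-D j j<q))
                   (X+[F-δ]≡X+F-δ ((g ℤ.+ P ℤ.+ P ℤ.+ + 3 ℤ.+ + j ℤ.+ + j) ℤ.* N) (F₂ j) δ))))
      ; at-gap = λ e L≤e e<s → on e (classify-none e L≤e (λ e≡s → ℕP.<-irrefl e≡s e<s)) refl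
      ; at-S = on s (classify-S L≤s)
          (trans (magnitude-S _ (ℕP.<⇒≤ (inverse<n (col s)))) (cong (λ z → (g ℤ.+ P ℤ.+ P ℤ.+ 1ℤ) ℤ.* N ℤ.- z) at-S))
      ; at-tail = λ e s<e →
          on e (classify-none e (ℕP.≤-trans L≤s (ℕP.<⇒≤ s<e)) (λ e≡s → ℕP.<-irrefl (sym e≡s) s<e)) refl
      ; L≤s = L≤s
      }

  open Congruence n
  open Cells n using (diag; diag+d≋r; diag-involutive; diag-injectiveˡ; diag-≤; diag->)

  2p≤n : double p ≤ n
  2p≤n = ℕP.≤-trans (ℕP.m≤m+n (double p) (double p)) 4p≤n

  1<n : 1 < n
  1<n = ℕP.≤-trans (s≤s (s≤s z≤n)) 2p≤n

  αu≋1 : α * u ≋ 1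
  αu≋1 = trans αu≡1 (sym (m<n⇒m%n≡m 1<n))

  private
    1+2k≤n : ∀ k → k < p → suc (double k) ≤ n
    1+2k≤n k k<p = ℕP.≤-trans (ℕP.<⇒≤ (double-mono-≤ k<p)) 2p≤n

    2p+2j+2≤n : ∀ j → j < q → suc (suc (double j + double p)) ≤ n
    2p+2j+2≤n j j<q = ℕP.≤-trans (ℕP.+-monoˡ-≤ (double p) (double-mono-≤ (ℕP.m≤n⇒m≤1+n j<q))) 4p≤n

  module Row (r : ℕ) where

    -- t is the column of the cell of row r on diagonal 2p.
    t t′ : ℕ
    t = (r + (n ∸ double p)) % n
    t′ = (t + (n ∸ 1)) % n

    ≋t : ∀ {y} → y + double p ≋ r → y ≋ t
    ≋t {y} y+2p≋r = ≋-cancelʳ (double p) (≋-trans y+2p≋r (≋-sym t+2p≋r))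
      where
        t+2p≋r : t + double p ≋ r
        t+2p≋r = ≋-trans (≋-+ (%-≋ (r + (n ∸ double p))) (≋-refl {double p}))
                   (≋-trans (≡⇒≋ (trans (ℕP.+-assoc r _ _) (cong (λ z → r + z) (ℕP.m∸n+n≡m 2p≤n)))) (+n-≋ r))

    ≋t′ : ∀ {y} → suc y + double p ≋ r → y % n ≡ t′
    ≋t′ 1+y+2p≋r = suc-≋⇒≋-pred (≋t 1+y+2p≋r)

    private
      shape-E/O : ∀ a b → a + (n ∸ double p) + b + double p ≡ (a + b) + n
      shape-E/O a b = trans (lemma a (n ∸ double p) b (double p)) (cong (λ z → (a + b) + z) (ℕP.m∸n+n≡m 2p≤n))
        where
          lemma : ∀ a X b c → a + X + b + c ≡ (a + b) + (X + c)
          lemma = NS.solve-∀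

      reaches : ∀ {d} → d ≤ n → ∀ {y} → y ≡ diag r d + d + n → y ≋ r
      reaches d≤n refl = ≋-trans (+n-≋ _) (diag+d≋r r d≤n)

      reaches′ : ∀ {d} → d ≤ n → ∀ {y} → y ≡ diag r d + d → y ≋ r
      reaches′ d≤n refl = diag+d≋r r d≤n

    offset-E : ∀ k → k < p → offsetEO k (diag r (double k)) ≡ suc t
    offset-E k k<p = cong suc (trans (≋t (reaches (ℕP.<⇒≤ (1+2k≤n k k<p)) (shape-E/O _ (double k))))
                                     (%-≋ (r + (n ∸ double p))))

    offset-O : ∀ k → k < p → offsetEO k (diag r (suc (double k))) ≡ suc t′
    offset-O k k<p = cong suc (≋t′ (reaches (1+2k≤n k k<p)
      (trans (cong (_+ double p) (sym (ℕP.+-suc (diag r (suc (double k)) + (n ∸ double p)) (double k))))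
             (shape-E/O _ (suc (double k))))))

    offset-C : ∀ j → j < q → offsetCD j (diag r (suc (double j + double p))) ≡ suc t
    offset-C j j<q = cong suc (trans (≋t (reaches′ (ℕP.<⇒≤ (2p+2j+2≤n j j<q))
                                                   (lemma (diag r (suc (double j + double p))) (double j) (double p))))
                                     (%-≋ (r + (n ∸ double p))))
      where
        lemma : ∀ a b c → a + suc b + c ≡ a + suc (b + c)
        lemma = NS.solve-∀

    offset-D : ∀ j → j < q → offsetCD j (diag r (suc (suc (double j + double p)))) ≡ suc t′
    offset-D j j<q = cong suc (≋t′ (reaches′ (2p+2j+2≤n j j<q)
                                            (lemma (diag r (suc (suc (double j + double p)))) (double j) (double p))))
      where
        lemma : ∀ a b c → suc (a + suc b) + c ≡ a + suc (suc (b + c))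
        lemma = NS.solve-∀

    t<n : t < n
    t<n = m%n<n (r + (n ∸ double p)) n

    κ κ′ : ℕ
    κ = inverse t
    κ′ = inverse (diag r s)

    κ′<n : κ′ < n
    κ′<n = inverse<n (diag r s)

    private
      n∸1+1≡n : n ∸ 1 + 1 ≡ n
      n∸1+1≡n = ℕP.m∸n+n≡m (ℕP.<⇒≤ 1<n)

      n∸1<n : n ∸ 1 < n
      n∸1<n = subst (n ∸ 1 <_) (trans (ℕP.+-comm 1 (n ∸ 1)) n∸1+1≡n) (ℕP.n<1+n (n ∸ 1))

      diag-s+α≋t : diag r s + α ≋ t
      diag-s+α≋t = ≋t (reaches′ (ℕP.<⇒≤ s<n)
        (trans (ℕP.+-assoc (diag r s) α (double p)) (cong (λ z → diag r s + z) (ℕP.+-comm α (double p)))))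

    κ≡[1+κ′]%n : κ ≡ suc κ′ % n
    κ≡[1+κ′]%n =
      ≋-trans (≋-* (≋-sym diag-s+α≋t) (≋-refl {u}))
        (≋-trans (≡⇒≋ (ℕP.*-distribʳ-+ u (diag r s) α))
          (≋-trans (≋-+ (≋-sym (%-≋ (diag r s * u))) αu≋1) (≡⇒≋ (ℕP.+-comm κ′ 1))))

    κ≡0⇒t≡0 : κ ≡ 0 → t ≡ 0
    κ≡0⇒t≡0 κ≡0 = ≋⇒≡ t≋0 t<n (ℕP.<-trans (s≤s z≤n) 1<n)
      where
        lemma : ∀ t a u → t * (a * u) ≡ t * u * a
        lemma = NS.solve-∀
        t≋0 : t ≋ 0
        t≋0 = ≋-trans (≡⇒≋ (sym (ℕP.*-identityʳ t)))
                (≋-trans (≋-* (≋-refl {t}) (≋-sym αu≋1))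
                  (≋-trans (≡⇒≋ (lemma t α u))
                    (≋-trans (≋-* (≋-sym (%-≋ (t * u))) (≋-refl {α})) (≡⇒≋ (cong (_* α) κ≡0)))))

    t′≡pred : ∀ {t₀} → t ≡ suc t₀ → t′ ≡ t₀
    t′≡pred {t₀} t≡1+t₀ = begin
      (t + (n ∸ 1)) % n       ≡⟨ cong (λ z → (z + (n ∸ 1)) % n) t≡1+t₀ ⟩
      (suc t₀ + (n ∸ 1)) % n  ≡⟨ cong (_% n) (trans (sym (ℕP.+-suc t₀ (n ∸ 1)))
                                                    (cong (λ z → t₀ + z) (trans (ℕP.+-comm 1 (n ∸ 1)) n∸1+1≡n))) ⟩
      (t₀ + n) % n            ≡⟨ [m+n]%n≡m%n t₀ n ⟩
      t₀ % n                  ≡⟨ m<n⇒m%n≡m (ℕP.<-trans (ℕP.n<1+n t₀) (subst (_< n) t≡1+t₀ t<n)) ⟩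
      t₀                      ∎
      where open ≡-Reasoning

    t′≡n∸1 : t ≡ 0 → t′ ≡ n ∸ 1
    t′≡n∸1 t≡0 = trans (cong (λ z → (z + (n ∸ 1)) % n) t≡0) (m<n⇒m%n≡m n∸1<n)

    κ≡1+κ′ : t ≢ 0 → κ ≡ suc κ′
    κ≡1+κ′ t≢0 with suc κ′ ℕP.<? n
    ... | yes 1+κ′<n = trans κ≡[1+κ′]%n (m<n⇒m%n≡m 1+κ′<n)
    ... | no  1+κ′≮n = ⊥-elim (t≢0 (κ≡0⇒t≡0 (trans κ≡[1+κ′]%n
                          (trans (cong (_% n) (ℕP.≤-antisym κ′<n (ℕP.≮⇒≥ 1+κ′≮n))) (n%n≡0 n)))))

    κ≡0 : t ≡ 0 → κ ≡ 0
    κ≡0 t≡0 = trans (cong inverse t≡0) (m<n⇒m%n≡m (ℕP.<-trans (s≤s z≤n) 1<n))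

    1+κ′≡n : t ≡ 0 → suc κ′ ≡ n
    1+κ′≡n t≡0 with suc κ′ ℕP.<? n
    ... | yes 1+κ′<n = ⊥-elim (1+κ′≢0 (trans (sym (m<n⇒m%n≡m 1+κ′<n)) (trans (sym κ≡[1+κ′]%n) (κ≡0 t≡0))))
      where
        1+κ′≢0 : suc κ′ ≢ 0
        1+κ′≢0 ()
    ... | no  1+κ′≮n = ℕP.≤-antisym κ′<n (ℕP.≮⇒≥ 1+κ′≮n)

  M : ℕ
  M = 2 * (4 * p + G) * n + 1

  rowLine colLine : ℕ → ℕ → ℤ
  rowLine r d = entry (classify d) (diag r d)
  colLine c d = entry (classify d) c

  private
    1≤n : 1 ≤ n
    1≤n = ℕP.<⇒≤ 1<n

    N≥4P : NonNeg (+ n ℤ.- + p ℤ.- + p ℤ.- + p ℤ.- + p)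
    N≥4P = nonNeg-≡ (trans (cong (λ z → + n ℤ.- z) (trans (ℤP.pos-+ (double p) (double p))
                                                         (cong₂ ℤ._+_ (pos-double p) (pos-double p))))
                           (lemma (+ n) (+ p)))
                    (nonNeg-gap 4p≤n)
      where
        lemma : ∀ N P → N ℤ.- ((P ℤ.+ P) ℤ.+ (P ℤ.+ P)) ≡ N ℤ.- P ℤ.- P ℤ.- P ℤ.- P
        lemma = solve-∀

    below-N : ∀ {x} → x < n → NonNeg (+ n ℤ.- 1ℤ ℤ.- + x)
    below-N {x} x<n = nonNeg-≡ (lemma (+ n) (+ x)) (nonNeg-gap-1 x<n)
      where
        lemma : ∀ N K → N ℤ.- K ℤ.- 1ℤ ≡ N ℤ.- 1ℤ ℤ.- K
        lemma = solve-∀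

    offset-range : ∀ {x} → x < n → NonNeg (+ suc x ℤ.- 1ℤ) × NonNeg (+ n ℤ.- + suc x)
    offset-range {x} x<n = nonNeg-≡ (sym (lemma (+ x))) (nonNeg-ℕ x) , nonNeg-gap x<n
      where
        lemma : ∀ X → (1ℤ ℤ.+ X) ℤ.+ ℤ.- 1ℤ ≡ X
        lemma = solve-∀

  record LineFacts (w : ℕ → ℤ) (Step : ℕ → ℕ) : Set where
    field
      closes : prefix w n ≡ 0ℤ
      apart  : ∀ d d′ → classify d ≢ none → classify d′ ≢ none → d ≢ d′ →
               ¬ ((+ M) ∣ (prefix w (Step d) ℤ.- prefix w (Step d′)))

  rowFacts-regular : ∀ r {t₀} → Row.t r ≡ suc t₀ → LineFacts (rowLine r) (λ d → d)
  rowFacts-regular r {t₀} t≡ = record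
    { closes = prefix-beyond-S fits balanced n s<n
    ; apart  = row-prefixes-distinct fits sorted M (width<modulus 1≤n)
    }
    where
      open Row r
      F : ℕ → ℤ
      F _ = + suc (suc t₀)
      open Profile.Shape n q G F F 1ℤ (+ κ) (+ κ′) using (prefix-beyond-S; width<modulus)
      open LinePrefixes n q G F F 1ℤ (+ κ) (+ κ′) using (row-prefixes-distinct)
      t′≡t₀ = t′≡pred t≡
      pred-F : + suc t₀ ≡ + suc (suc t₀) ℤ.- 1ℤ
      pred-F = sym (trans (cong (ℤ._- 1ℤ) (pos-suc (suc t₀))) (lemma (+ suc t₀)))
        where
          lemma : ∀ X → (1ℤ ℤ.+ X) ℤ.- 1ℤ ≡ X
          lemma = solve-∀
      fits = LineFits.fits (diag r) F F 1ℤ (+ κ) (+ κ′)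
               (λ k k<p → cong +_ (trans (offset-E k k<p) (cong suc t≡)))
               (λ k k<p → trans (cong +_ (trans (offset-O k k<p) (cong suc t′≡t₀))) pred-F)
               refl
               (λ j j<q → cong +_ (trans (offset-C j j<q) (cong suc t≡)))
               (λ j j<q → trans (cong +_ (trans (offset-D j j<q) (cong suc t′≡t₀))) pred-F)
               refl
      balanced : + κ ℤ.- + κ′ ≡ 1ℤ
      balanced = trans (cong (λ z → + z ℤ.- + κ′) (κ≡1+κ′ (λ t≡0 → case (trans (sym t≡) t≡0) of λ ())))
                       (trans (cong (ℤ._- + κ′) (pos-suc κ′)) (lemma (+ κ′)))
        where
          lemma : ∀ K → (1ℤ ℤ.+ K) ℤ.- K ≡ 1ℤ
          lemma = solve-∀
      F-range : ∀ k → NonNeg (F k ℤ.- 1ℤ) × NonNeg (+ n ℤ.- F k)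
      F-range _ = offset-range (subst (_< n) t≡ t<n)
      sorted = Regimes.Regular.sorted n q G F F 1ℤ (+ κ) (nonNeg-ℕ 1) (nonNeg-ℕ 0) (nonNeg-ℕ κ) (below-N (inverse<n t)) N≥4P
                 (λ k _ → F-range k) (λ j _ → F-range j)

  rowFacts-wrapped : ∀ r → Row.t r ≡ 0 → LineFacts (rowLine r) (λ d → d)
  rowFacts-wrapped r t≡ = record
    { closes = prefix-beyond-S fits balanced n s<n
    ; apart  = row-prefixes-distinct fits sorted M (width<modulus 1≤n)
    }
    where
      open Row r
      F : ℕ → ℤ
      F _ = 1ℤ
      δ : ℤ
      δ = 1ℤ ℤ.- + n
      open Profile.Shape n q G F F δ 0ℤ (+ κ′) using (prefix-beyond-S; width<modulus)
      open LinePrefixes n q G F F δ 0ℤ (+ κ′) using (row-prefixes-distinct)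
      n≡1-δ : + n ≡ 1ℤ ℤ.- δ
      n≡1-δ = sym (lemma (+ n))
        where
          lemma : ∀ N → 1ℤ ℤ.- (1ℤ ℤ.- N) ≡ N
          lemma = solve-∀
      1+[n∸1]≡n : suc (n ∸ 1) ≡ n
      1+[n∸1]≡n = trans (ℕP.+-comm 1 (n ∸ 1)) (ℕP.m∸n+n≡m 1≤n)
      top : ∀ {x} → x ≡ suc t′ → + x ≡ 1ℤ ℤ.- δ
      top e = trans (cong +_ (trans e (trans (cong suc (t′≡n∸1 t≡)) 1+[n∸1]≡n))) n≡1-δ
      fits = LineFits.fits (diag r) F F δ 0ℤ (+ κ′)
               (λ k k<p → cong +_ (trans (offset-E k k<p) (cong suc t≡)))
               (λ k k<p → top (offset-O k k<p))
               (cong +_ (κ≡0 t≡))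
               (λ j j<q → cong +_ (trans (offset-C j j<q) (cong suc t≡)))
               (λ j j<q → top (offset-D j j<q))
               refl
      balanced : 0ℤ ℤ.- + κ′ ≡ δ
      balanced = trans (sym (lemma (+ κ′))) (cong (λ z → 1ℤ ℤ.- z) (trans (sym (pos-suc κ′)) (cong +_ (1+κ′≡n t≡))))
        where
          lemma : ∀ K → 1ℤ ℤ.- (1ℤ ℤ.+ K) ≡ 0ℤ ℤ.- K
          lemma = solve-∀
      sorted = Regimes.Wrapped.sorted n q G (nonNeg-gap 1≤n)

  rowFacts : ∀ r → LineFacts (rowLine r) (λ d → d)
  rowFacts r with Row.t r in t≡
  ... | suc _ = rowFacts-regular r t≡
  ... | zero  = rowFacts-wrapped r t≡

  colFacts : ∀ c → LineFacts (colLine c) suc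
  colFacts c = record
    { closes = prefix-beyond-S fits balanced n s<n
    ; apart  = col-prefixes-distinct fits sorted M (width<modulus 1≤n) balanced
    }
    where
      F₁ F₂ : ℕ → ℤ
      F₁ k = + offsetEO k c
      F₂ j = + offsetCD j c
      κ : ℤ
      κ = + inverse c
      open Profile.Shape n q G F₁ F₂ 0ℤ κ κ using (prefix-beyond-S; width<modulus)
      open LinePrefixes n q G F₁ F₂ 0ℤ κ κ using (col-prefixes-distinct)
      fits = LineFits.fits (λ _ → c) F₁ F₂ 0ℤ κ κ
               (λ _ _ → refl) (λ _ _ → sym (ℤP.+-identityʳ _)) refl (λ _ _ → refl) (λ _ _ → sym (ℤP.+-identityʳ _)) refl
      balanced : κ ℤ.- κ ≡ 0ℤ
      balanced = ℤP.+-inverseʳ κ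
      sorted = Regimes.Regular.sorted n q G F₁ F₂ 0ℤ κ (nonNeg-ℕ 0) (nonNeg-ℕ 1) (nonNeg-ℕ _) (below-N (inverse<n c)) N≥4P
                 (λ k _ → offset-range (m%n<n _ n)) (λ j _ → offset-range (m%n<n _ n))

  place : Diagonal → ℤ → Maybe ℤ
  place none _ = nothing
  place _    x = just x

  array : Array n
  array r c = place (classify d) (entry (classify d) (toℕ c))
    where d = diag (toℕ r) (toℕ c)

  private
    place-cases : ∀ cl → cl ≡ none ⊎ (∀ x → place cl x ≡ just x)
    place-cases (E _) = inj₂ λ _ → refl
    place-cases (O _) = inj₂ λ _ → refl
    place-cases (C _) = inj₂ λ _ → refl
    place-cases (D _) = inj₂ λ _ → refl
    place-cases X     = inj₂ λ _ → refl
    place-cases S     = inj₂ λ _ → refl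
    place-cases none  = inj₁ refl

  placed : ∀ cl → cl ≢ none → ∀ x → place cl x ≡ just x
  placed cl cl≢none x with place-cases cl
  ... | inj₁ cl≡none = ⊥-elim (cl≢none cl≡none)
  ... | inj₂ just-x  = just-x x

  placed⇒≢none : ∀ cl {x y} → place cl x ≡ just y → cl ≢ none
  placed⇒≢none cl () refl

  placed⇒≡ : ∀ cl {x y} → place cl x ≡ just y → x ≡ y
  placed⇒≡ cl {x} eq with place-cases cl
  ... | inj₁ refl   = case eq of λ ()
  ... | inj₂ just-x = just-injective (trans (sym (just-x x)) eq)

  fromMaybe-place-entry : ∀ cl i → fromMaybe 0ℤ (place cl (entry cl i)) ≡ entry cl i
  fromMaybe-place-entry cl i with place-cases cl
  ... | inj₁ refl   = refl
  ... | inj₂ just-x = cong (fromMaybe 0ℤ) (just-x _)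

  mark-place : ∀ cl x y → mark (place cl x) ≡ mark (place cl y)
  mark-place cl x y with place-cases cl
  ... | inj₁ refl   = refl
  ... | inj₂ just-x = trans (cong mark (just-x x)) (sym (cong mark (just-x y)))

  countLine : ℕ → ℤ
  countLine d = mark (place (classify d) 0ℤ)

  private
    count-filled : ∀ d → d < L ⊎ d ≡ s → countLine d ≡ 1ℤ
    count-filled d d∈ = cong mark (placed (classify d) (Layout.below-L-or-S⇒filled q s d d∈) 0ℤ)

    count-empty : ∀ e → L ≤ e → e ≢ s → countLine e ≡ 0ℤ
    count-empty e L≤e e≢s = cong (λ cl → mark (place cl 0ℤ)) (classify-none e L≤e e≢s)

    x+1≡1+x : ∀ x → + x ℤ.+ 1ℤ ≡ + suc x
    x+1≡1+x x = trans (ℤP.+-comm (+ x) 1ℤ) (sym (pos-suc x))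

  prefix-count-≤L : ∀ e → e ≤ L → prefix countLine e ≡ + e
  prefix-count-≤L zero    _     = refl
  prefix-count-≤L (suc e) e<L =
    trans (cong₂ ℤ._+_ (prefix-count-≤L e (ℕP.<⇒≤ e<L)) (count-filled e (inj₁ e<L))) (x+1≡1+x e)

  prefix-count-≤s : ∀ e → L ≤ e → e ≤ s → prefix countLine e ≡ + L
  prefix-count-≤s zero    () _
  prefix-count-≤s (suc e) L≤1+e 1+e≤s with L ℕP.≤? e
  ... | yes L≤e = trans (cong₂ ℤ._+_ (prefix-count-≤s e L≤e (ℕP.<⇒≤ 1+e≤s))
                                     (count-empty e L≤e (λ e≡s → ℕP.<-irrefl e≡s 1+e≤s)))
                        (ℤP.+-identityʳ _)
  ... | no  L≰e = subst (λ z → prefix countLine z ≡ + L) (ℕP.≤-antisym L≤1+e (ℕP.≰⇒> L≰e))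
                        (prefix-count-≤L L ℕP.≤-refl)

  prefix-count->s : ∀ e → s < e → prefix countLine e ≡ + suc L
  prefix-count->s (suc e) s<1+e with s ℕP.<? e
  ... | yes s<e = trans (cong₂ ℤ._+_ (prefix-count->s e s<e)
                                     (count-empty e (ℕP.≤-trans L≤s (ℕP.<⇒≤ s<e)) (λ e≡s → ℕP.<-irrefl (sym e≡s) s<e)))
                        (ℤP.+-identityʳ _)
  ... | no  s≮e with ℕP.≤-antisym (ℕP.≤-pred s<1+e) (ℕP.≮⇒≥ s≮e)
  ...   | refl = trans (cong₂ ℤ._+_ (prefix-count-≤s s L≤s ℕP.≤-refl) (count-filled s (inj₂ refl))) (x+1≡1+x L)

  4p≡1+L : 4 * p ≡ suc L
  4p≡1+L = trans (lemma q) (cong (λ z → suc (suc (z + suc (suc z)))) (sym (double≡2* q)))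
    where
      lemma : ∀ q → 4 * suc q ≡ suc (suc (2 * q + suc (suc (2 * q))))
      lemma = NS.solve-∀

  private
    [A-a]-[A-b]≡b-a : ∀ A a b → (A ℤ.- a) ℤ.- (A ℤ.- b) ≡ b ℤ.- a
    [A-a]-[A-b]≡b-a = solve-∀
    [a-B]-[b-B]≡a-b : ∀ a b B → (a ℤ.- B) ℤ.- (b ℤ.- B) ≡ a ℤ.- b
    [a-B]-[b-B]≡a-b = solve-∀
    count-total : prefix countLine n ≡ + (4 * p)
    count-total = trans (prefix-count->s n s<n) (cong +_ (sym 4p≡1+L))

  module RowOf (r : Fin n) where
    private
      ρ = toℕ r
      ρ<n = FinP.toℕ<n r
      open LineFacts (rowFacts ρ)
      module Values = Cells.LineSums n (rowLine ρ)
      module Counts = Cells.LineSums n countLine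

    values-telescope : Telescopes (array r) (λ i → i) (fromMaybe 0ℤ) (Values.rowSum ρ)
    values-telescope i = cong (λ z → Values.rowSum ρ (toℕ i) ℤ.+ z)
      (trans (cong (entry (classify (diag ρ (toℕ i)))) (diag-involutive ρ (toℕ i) (FinP.toℕ<n i)))
             (sym (fromMaybe-place-entry (classify (diag ρ (toℕ i))) (toℕ i))))

    counts-telescope : Telescopes (array r) (λ i → i) mark (Counts.rowSum ρ)
    counts-telescope i = cong (λ z → Counts.rowSum ρ (toℕ i) ℤ.+ z) (mark-place (classify (diag ρ (toℕ i))) 0ℤ _)

    sum≡0 : sumℤ (rowEntries array r) ≡ + 0
    sum≡0 = trans (sum-telescopes (array r) n (λ i → i) (Values.rowSum ρ) values-telescope)
                  (trans (ℤP.+-identityʳ _) (trans (Values.rowSum-total ρ<n) closes))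

    length≡4p : length (rowEntries array r) ≡ 4 * p
    length≡4p = ℤP.+-injective (trans (length-telescopes (array r) n (λ i → i) (Counts.rowSum ρ) counts-telescope)
                  (trans (ℤP.+-identityʳ _) (trans (Counts.rowSum-total ρ<n) count-total)))

    simple : DistinctMod (2 * (4 * p + G) * n + 1) (partialSums (rowEntries array r))
    simple = partialSums-distinctMod (array r) n (λ i → i) (Values.rowSum ρ) values-telescope M apart′
      where
        apart′ : ∀ (i j : Fin n) → toℕ i < toℕ j → Occupied (array r) i → Occupied (array r) j →
                 ¬ ((+ M) ∣ (Values.rowSum ρ (suc (toℕ i)) ℤ.- Values.rowSum ρ (suc (toℕ j))))
        apart′ i j i<j (_ , eqᵢ) (_ , eqⱼ) =
          subst (λ z → ¬ ((+ M) ∣ z))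
            (sym (trans (cong₂ ℤ._-_ (Values.rowSum-closed closes ρ<n (toℕ i) (FinP.toℕ<n i))
                                     (Values.rowSum-closed closes ρ<n (toℕ j) (FinP.toℕ<n j)))
                        ([A-a]-[A-b]≡b-a (prefix (rowLine ρ) (suc ρ)) _ _)))
            (apart (diag ρ (toℕ j)) (diag ρ (toℕ i)) (placed⇒≢none _ eqⱼ) (placed⇒≢none _ eqᵢ) dⱼ≢dᵢ)
          where
            dⱼ≢dᵢ : diag ρ (toℕ j) ≢ diag ρ (toℕ i)
            dⱼ≢dᵢ e = ℕP.<-irrefl (trans (sym (diag-involutive ρ (toℕ i) (FinP.toℕ<n i)))
                                   (trans (cong (diag ρ) (sym e)) (diag-involutive ρ (toℕ j) (FinP.toℕ<n j)))) i<j

  module ColumnOf (c : Fin n) where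
    private
      γ = toℕ c
      γ<n = FinP.toℕ<n c
      open LineFacts (colFacts γ)
      module Values = Cells.LineSums n (colLine γ)
      module Counts = Cells.LineSums n countLine

    values-telescope : Telescopes (λ r → array r c) (λ i → i) (fromMaybe 0ℤ) (Values.colSum γ)
    values-telescope i = cong (λ z → Values.colSum γ (toℕ i) ℤ.+ z) (sym (fromMaybe-place-entry (classify (diag (toℕ i) γ)) γ))

    counts-telescope : Telescopes (λ r → array r c) (λ i → i) mark (Counts.colSum γ)
    counts-telescope i = cong (λ z → Counts.colSum γ (toℕ i) ℤ.+ z) (mark-place (classify (diag (toℕ i) γ)) 0ℤ _)

    sum≡0 : sumℤ (colEntries array c) ≡ + 0
    sum≡0 = trans (sum-telescopes (λ r → array r c) n (λ i → i) (Values.colSum γ) values-telescope)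
                  (trans (ℤP.+-identityʳ _) (trans (Values.colSum-total γ γ<n) closes))

    length≡4p : length (colEntries array c) ≡ 4 * p
    length≡4p = ℤP.+-injective (trans (length-telescopes (λ r → array r c) n (λ i → i) (Counts.colSum γ) counts-telescope)
                  (trans (ℤP.+-identityʳ _) (trans (Counts.colSum-total γ γ<n) count-total)))

    simple : DistinctMod (2 * (4 * p + G) * n + 1) (partialSums (colEntries array c))
    simple = partialSums-distinctMod (λ r → array r c) n (λ i → i) (Values.colSum γ) values-telescope M apart′
      where
        apart′ : ∀ (i j : Fin n) → toℕ i < toℕ j → Occupied (λ r → array r c) i → Occupied (λ r → array r c) j →
                 ¬ ((+ M) ∣ (Values.colSum γ (suc (toℕ i)) ℤ.- Values.colSum γ (suc (toℕ j))))
        apart′ i j i<j (_ , eqᵢ) (_ , eqⱼ) =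
          subst (λ z → ¬ ((+ M) ∣ z))
            (sym (trans (cong₂ ℤ._-_ (Values.colSum-closed closes γ γ<n (toℕ i) (FinP.toℕ<n i))
                                     (Values.colSum-closed closes γ γ<n (toℕ j) (FinP.toℕ<n j)))
                        ([a-B]-[b-B]≡a-b (prefix (colLine γ) (suc (diag (toℕ i) γ))) (prefix (colLine γ) (suc (diag (toℕ j) γ)))
                                          (prefix (colLine γ) (n ∸ γ)))))
            (apart (diag (toℕ i) γ) (diag (toℕ j) γ) (placed⇒≢none _ eqᵢ) (placed⇒≢none _ eqⱼ)
                   (λ e → ℕP.<-irrefl (diag-injectiveˡ γ (FinP.toℕ<n i) (FinP.toℕ<n j) e) i<j))

  InSupport : ℕ → Set
  InSupport m = G * n + 1 ≤ m × m ≤ (4 * p + G) * n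

  magnitude-inSupport : ∀ b h → b ≤ L → 1 ≤ h → h ≤ n → InSupport (magnitude b h)
  magnitude-inSupport b h b≤L 1≤h h≤n = lower , upper
    where
      lower : G * n + 1 ≤ magnitude b h
      lower = ℕP.+-mono-≤ (ℕP.*-monoˡ-≤ n (ℕP.m≤m+n G b)) 1≤h
      1+G+b≤4p+G : suc (G + b) ≤ 4 * p + G
      1+G+b≤4p+G = subst (suc (G + b) ≤_) (trans (ℕP.+-comm G (suc L)) (cong (_+ G) (sym 4p≡1+L)))
                     (subst (_≤ G + suc L) (ℕP.+-suc G b) (ℕP.+-monoʳ-≤ G (s≤s b≤L)))
      upper : magnitude b h ≤ (4 * p + G) * n
      upper = ℕP.≤-trans (ℕP.+-monoʳ-≤ ((G + b) * n) h≤n)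
                (ℕP.≤-trans (ℕP.≤-reflexive (ℕP.+-comm ((G + b) * n) n)) (ℕP.*-monoˡ-≤ n 1+G+b≤4p+G))

  block : Diagonal → ℕ
  block (E k) = double k
  block (O k) = suc (double k)
  block X     = suc (double p)
  block (C j) = suc (suc (double j + double p))
  block (D j) = suc (suc (suc (double j + double p)))
  block S     = double p
  block none  = 0

  offset : Diagonal → ℕ → ℕ
  offset (E k) i = offsetEO k i
  offset (O k) i = offsetEO k i
  offset X     i = n ∸ inverse i
  offset (C j) i = offsetCD j i
  offset (D j) i = offsetCD j i
  offset S     i = n ∸ inverse i
  offset none  i = 0

  ∣entry∣≡magnitude : ∀ cl i → cl ≢ none → ℤ.∣ entry cl i ∣ ≡ magnitude (block cl) (offset cl i)
  ∣entry∣≡magnitude (E k) i _ = ℤP.∣-i∣≡∣i∣ (+ magnitude (block (E k)) (offset (E k) i))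
  ∣entry∣≡magnitude (O k) i _ = refl
  ∣entry∣≡magnitude X     i _ = ℤP.∣-i∣≡∣i∣ (+ magnitude (block X) (offset X i))
  ∣entry∣≡magnitude (C j) i _ = refl
  ∣entry∣≡magnitude (D j) i _ = ℤP.∣-i∣≡∣i∣ (+ magnitude (block (D j)) (offset (D j) i))
  ∣entry∣≡magnitude S     i _ = refl
  ∣entry∣≡magnitude none  i ≢none = ⊥-elim (≢none refl)

  offset-bounds : ∀ cl i → cl ≢ none → 1 ≤ offset cl i × offset cl i ≤ n
  offset-bounds (E k) i _ = s≤s z≤n , m%n<n _ n
  offset-bounds (O k) i _ = s≤s z≤n , m%n<n _ n
  offset-bounds X     i _ = ℕP.m<n⇒0<n∸m (inverse<n i) , ℕP.m∸n≤m n (inverse i)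
  offset-bounds (C j) i _ = s≤s z≤n , m%n<n _ n
  offset-bounds (D j) i _ = s≤s z≤n , m%n<n _ n
  offset-bounds S     i _ = ℕP.m<n⇒0<n∸m (inverse<n i) , ℕP.m∸n≤m n (inverse i)
  offset-bounds none  i ≢none = ⊥-elim (≢none refl)

  block≤L : ∀ d → (≢none : classify d ≢ none) → block (classify d) ≤ L
  block≤L d ≢none with Layout.view q s d ≢none
  ... | Layout.vE k k<p refl rewrite classify-E k k<p = ℕP.≤-trans (ℕP.<⇒≤ (double-mono-< k<p)) (Layout.2p≤L q s)
  ... | Layout.vO k k<p refl rewrite classify-O k k<p = ℕP.≤-trans (ℕP.<⇒≤ (double-mono-≤ k<p)) (Layout.2p≤L q s)
  ... | Layout.vX refl       rewrite classify-X       = s≤s (Layout.2p≤2p+2j q s q)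
  ... | Layout.vC j j<q refl rewrite classify-C j j<q = s≤s (ℕP.+-monoˡ-≤ (double p) (ℕP.<⇒≤ (double-mono-≤ j<q)))
  ... | Layout.vD j j<q refl rewrite classify-D j j<q = s≤s (ℕP.+-monoˡ-≤ (double p) (double-mono-≤ j<q))
  ... | Layout.vS refl       rewrite classify-S L≤s   = Layout.2p≤L q s

  entry-inSupport : ∀ d i → classify d ≢ none → InSupport ℤ.∣ entry (classify d) i ∣
  entry-inSupport d i ≢none = subst InSupport (sym (∣entry∣≡magnitude (classify d) i ≢none))
    (magnitude-inSupport _ _ (block≤L d ≢none) (proj₁ (offset-bounds (classify d) i ≢none))
                                               (proj₂ (offset-bounds (classify d) i ≢none)))

  block-decomposition : ∀ k → InSupport k → Σ ℕ λ b → Σ ℕ λ o → b ≤ L × o < n × k ≡ magnitude b (suc o)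
  block-decomposition k (lower , upper) = m / n , m % n , b≤L , m%n<n m n , k≡
    where
      m = k ∸ (G * n + 1)
      k≡ : k ≡ magnitude (m / n) (suc (m % n))
      k≡ = trans (sym (ℕP.m∸n+n≡m lower)) (trans (cong (_+ (G * n + 1)) (m≡m%n+[m/n]*n m n)) (lemma (m % n) (m / n) n G))
        where
          lemma : ∀ o b n G → o + b * n + (G * n + 1) ≡ (G + b) * n + suc o
          lemma = NS.solve-∀
      m<4pn : m < 4 * p * n
      m<4pn = ℕP.+-cancelʳ-≤ (G * n) (suc m) (4 * p * n)
        (subst (_≤ 4 * p * n + G * n) (lemma m (G * n))
          (subst (_≤ 4 * p * n + G * n) (sym (ℕP.m∸n+n≡m lower)) (subst (k ≤_) (ℕP.*-distribʳ-+ n (4 * p) G) upper)))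
        where
          lemma : ∀ m g → m + (g + 1) ≡ suc m + g
          lemma = NS.solve-∀
      b≤L : m / n ≤ L
      b≤L = ℕP.≤-pred (subst (m / n <_) 4p≡1+L (m<n*o⇒m/o<n m<4pn))

  L<n : L < n
  L<n = ℕP.≤-<-trans L≤s s<n

  diagonal-of-block : ∀ b → b ≤ L → Σ ℕ λ d → d < n × Σ (classify d ≢ none) λ _ → block (classify d) ≡ b
  diagonal-of-block b b≤L with b ℕP.<? double p
  ... | yes b<2p with halve b in eq
  ...   | inj₁ k = b , b<n , subst (_≢ none) (sym cl≡) (λ ()) , trans (cong block cl≡) (sym b≡)
    where
      b≡ = halve≡inj₁⇒double b eq
      b<n = ℕP.<-≤-trans b<2p (ℕP.≤-trans (Layout.2p≤L q s) (ℕP.<⇒≤ L<n))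
      cl≡ = trans (cong classify b≡) (classify-E k (double-cancel-< (subst (_< double p) b≡ b<2p)))
  ...   | inj₂ k = b , b<n , subst (_≢ none) (sym cl≡) (λ ()) , trans (cong block cl≡) (sym b≡)
    where
      b≡ = halve≡inj₂⇒suc-double b eq
      b<n = ℕP.<-≤-trans b<2p (ℕP.≤-trans (Layout.2p≤L q s) (ℕP.<⇒≤ L<n))
      cl≡ = trans (cong classify b≡) (classify-O k (suc-double<double⇒< (subst (_< double p) b≡ b<2p)))
  diagonal-of-block b b≤L | no b≮2p with b ℕP.≟ double p
  ... | yes b≡2p = s , s<n , subst (_≢ none) (sym (classify-S L≤s)) (λ ()) ,
                   trans (cong block (classify-S L≤s)) (sym b≡2p)
  ... | no b≢2p with b ℕP.≟ suc (double p)
  ...   | yes b≡2p+1 = double p , ℕP.<-≤-trans (s≤s (Layout.2p≤2p+2j q s q)) (ℕP.<⇒≤ L<n) ,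
                       subst (_≢ none) (sym classify-X) (λ ()) , trans (cong block classify-X) (sym b≡2p+1)
  ...   | no b≢2p+1 with halve (b ∸ suc (suc (double p))) in eq
  ...     | inj₁ j = _ , ℕP.≤-<-trans (ℕP.n≤1+n _) (ℕP.≤-<-trans (subst (_≤ L) b≡ b≤L) L<n) ,
                     subst (_≢ none) (sym cl≡) (λ ()) , trans (cong block cl≡) (sym b≡)
    where
      2p+2≤b = ℕP.≤∧≢⇒< (ℕP.≤∧≢⇒< (ℕP.≮⇒≥ b≮2p) (λ x → b≢2p (sym x))) (λ x → b≢2p+1 (sym x))
      b≡ : b ≡ suc (suc (double j + double p))
      b≡ = trans (sym (ℕP.m∸n+n≡m 2p+2≤b)) (trans (cong (_+ suc (suc (double p))) (halve≡inj₁⇒double _ eq))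
             (trans (ℕP.+-suc (double j) (suc (double p))) (cong suc (ℕP.+-suc (double j) (double p)))))
      j<q = suc-double≤double⇒< (ℕP.+-cancelʳ-≤ (double p) (suc (double j)) (double q) (ℕP.≤-pred (subst (_≤ L) b≡ b≤L)))
      cl≡ = classify-C j j<q
  ...     | inj₂ j = _ , ℕP.≤-<-trans (ℕP.n≤1+n _) (ℕP.≤-<-trans (subst (_≤ L) b≡ b≤L) L<n) ,
                     subst (_≢ none) (sym cl≡) (λ ()) , trans (cong block cl≡) (sym b≡)
    where
      2p+2≤b = ℕP.≤∧≢⇒< (ℕP.≤∧≢⇒< (ℕP.≮⇒≥ b≮2p) (λ x → b≢2p (sym x))) (λ x → b≢2p+1 (sym x))
      b≡ : b ≡ suc (suc (suc (double j + double p)))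
      b≡ = trans (sym (ℕP.m∸n+n≡m 2p+2≤b)) (trans (cong (_+ suc (suc (double p))) (halve≡inj₂⇒suc-double _ eq))
             (cong suc (trans (ℕP.+-suc (double j) (suc (double p))) (cong suc (ℕP.+-suc (double j) (double p))))))
      j<q = double-cancel-≤ (ℕP.+-cancelʳ-≤ (double p) (suc (suc (double j))) (double q) (ℕP.≤-pred (subst (_≤ L) b≡ b≤L)))
      cl≡ = classify-D j j<q

  private
    ≡%⇒offset : ∀ {x o} → o < n → x ≋ o → suc (x % n) ≡ suc o
    ≡%⇒offset {x} {o} o<n x≋o = cong suc (trans x≋o (m<n⇒m%n≡m o<n))

  private
    EO-onto : ∀ k → k < p → ∀ o → o < n → offsetEO k ((o + (double p + (n ∸ double k))) % n) ≡ suc o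
    EO-onto k k<p o o<n = ≡%⇒offset o<n
      (≋-trans (≋-+ (≋-+ (%-≋ (o + (double p + (n ∸ double k)))) (≋-refl {n ∸ double p})) (≋-refl {double k}))
        (≋-trans (≡⇒≋ rearranged) (≋-trans (+n-≋ (o + n)) (+n-≋ o))))
      where
        lemma : ∀ o P X Y K → o + (P + X) + Y + K ≡ o + (Y + P) + (X + K)
        lemma = NS.solve-∀
        rearranged : o + (double p + (n ∸ double k)) + (n ∸ double p) + double k ≡ o + n + n
        rearranged = trans (lemma o (double p) (n ∸ double k) (n ∸ double p) (double k))
          (cong₂ (λ a b → o + a + b) (ℕP.m∸n+n≡m 2p≤n) (ℕP.m∸n+n≡m (ℕP.≤-trans (ℕP.n≤1+n _) (1+2k≤n k k<p))))

    CD-onto : ∀ j → j < q → ∀ o → o < n → offsetCD j ((o + (n ∸ suc (double j))) % n) ≡ suc o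
    CD-onto j j<q o o<n = ≡%⇒offset o<n
      (≋-trans (≋-+ (%-≋ (o + (n ∸ suc (double j)))) (≋-refl {suc (double j)}))
        (≋-trans (≡⇒≋ (trans (ℕP.+-assoc o _ _) (cong (λ z → o + z) (ℕP.m∸n+n≡m 1+2j≤n)))) (+n-≋ o)))
      where
        1+2j≤n : suc (double j) ≤ n
        1+2j≤n = ℕP.≤-trans (ℕP.≤-trans (ℕP.n≤1+n _) (s≤s (ℕP.m≤m+n (suc (double j)) (double p)))) (2p+2j+2≤n j j<q)

    inverse-onto : ∀ o → o < n → n ∸ inverse (((n ∸ suc o) * α) % n) ≡ suc o
    inverse-onto o o<n = trans (cong (n ∸_) inverse≡) (ℕP.m∸[m∸n]≡n o<n)
      where
        x = n ∸ suc o
        inverse≡ : inverse ((x * α) % n) ≡ x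
        inverse≡ = ≋⇒≡ (≋-trans (%-≋ ((x * α) % n * u)) (≋-trans (≋-* (%-≋ (x * α)) (≋-refl {u}))
                         (≋-trans (≡⇒≋ (ℕP.*-assoc x α u))
                           (≋-trans (≋-* (≋-refl {x}) αu≋1) (≡⇒≋ (ℕP.*-identityʳ x))))))
                       (inverse<n ((x * α) % n)) (ℕP.∸-monoʳ-< {n} {suc o} {0} (s≤s z≤n) o<n)

  offset-onto : ∀ d → classify d ≢ none → ∀ o → o < n → Σ ℕ λ i → i < n × offset (classify d) i ≡ suc o
  offset-onto d ≢none o o<n with Layout.view q s d ≢none
  ... | Layout.vE k k<p refl rewrite classify-E k k<p = _ , m%n<n _ n , EO-onto k k<p o o<n
  ... | Layout.vO k k<p refl rewrite classify-O k k<p = _ , m%n<n _ n , EO-onto k k<p o o<n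
  ... | Layout.vX refl       rewrite classify-X       = _ , m%n<n _ n , inverse-onto o o<n
  ... | Layout.vC j j<q refl rewrite classify-C j j<q = _ , m%n<n _ n , CD-onto j j<q o o<n
  ... | Layout.vD j j<q refl rewrite classify-D j j<q = _ , m%n<n _ n , CD-onto j j<q o o<n
  ... | Layout.vS refl       rewrite classify-S L≤s   = _ , m%n<n _ n , inverse-onto o o<n

  cell-at : ∀ d i → d < n → i < n → Σ (Fin n) λ r → Σ (Fin n) λ c → toℕ c ≡ i × diag (toℕ r) (toℕ c) ≡ d
  cell-at d i d<n i<n = fromℕ< (m%n<n (i + d) n) , fromℕ< i<n , FinP.toℕ-fromℕ< i<n , on-d
    where
      i+d+[n∸i]≡d+n : i + d + (n ∸ i) ≡ d + n
      i+d+[n∸i]≡d+n = trans (ℕP.+-assoc i d (n ∸ i)) (trans (cong (λ z → i + z) (ℕP.+-comm d (n ∸ i)))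
        (trans (sym (ℕP.+-assoc i (n ∸ i) d)) (trans (cong (_+ d) (ℕP.m+[n∸m]≡n (ℕP.<⇒≤ i<n))) (ℕP.+-comm n d))))
      on-d : diag (toℕ (fromℕ< (m%n<n (i + d) n))) (toℕ (fromℕ< i<n)) ≡ d
      on-d rewrite FinP.toℕ-fromℕ< (m%n<n (i + d) n) | FinP.toℕ-fromℕ< i<n =
        trans (≋-trans (≋-+ (%-≋ (i + d)) (≋-refl {n ∸ i})) (≋-trans (≡⇒≋ i+d+[n∸i]≡d+n) (+n-≋ d)))
              (m<n⇒m%n≡m d<n)

  support-attained : ∀ k → G * n + 1 ≤ k → k ≤ (4 * p + G) * n →
                     Σ (Fin n) λ r → Σ (Fin n) λ c → Σ ℤ λ x → array r c ≡ just x × ℤ.∣ x ∣ ≡ k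
  support-attained k lower upper with block-decomposition k (lower , upper)
  ... | b , o , b≤L , o<n , k≡ with diagonal-of-block b b≤L
  ...   | d , d<n , ≢none , block≡b with offset-onto d ≢none o o<n
  ...     | i , i<n , offset≡1+o with cell-at d i d<n i<n
  ...       | r , c , c≡i , diag≡d = r , c , entry (classify d) i , array≡ , ∣x∣≡k
    where
      array≡ : array r c ≡ just (entry (classify d) i)
      array≡ rewrite diag≡d | c≡i = placed (classify d) ≢none _
      ∣x∣≡k : ℤ.∣ entry (classify d) i ∣ ≡ k
      ∣x∣≡k = trans (∣entry∣≡magnitude (classify d) i ≢none) (trans (cong₂ magnitude block≡b offset≡1+o) (sym k≡))

  entries-inSupport : ∀ r c x → array r c ≡ just x → InSupport ℤ.∣ x ∣
  entries-inSupport r c x eq =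
    subst (λ z → InSupport ℤ.∣ z ∣) (placed⇒≡ _ eq)
          (entry-inSupport (diag (toℕ r) (toℕ c)) (toℕ c) (placed⇒≢none _ eq))

  inDiag-diag : ∀ (r c : Fin n) → InDiag n (diag (toℕ r) (toℕ c)) r c
  inDiag-diag r c with ℕP.≤-<-connex (toℕ c) (toℕ r)
  ... | inj₁ c≤r = inj₁ (trans (sym (ℕP.m+[n∸m]≡n c≤r)) (cong (λ z → toℕ c + z) (sym (diag-≤ c≤r (FinP.toℕ<n r)))))
  ... | inj₂ r<c = inj₂ (trans r+n≡c+[r+[n∸c]] (cong (λ z → toℕ c + z) (sym (diag-> r<c (ℕP.<⇒≤ (FinP.toℕ<n c))))))
    where
      r+n≡c+[r+[n∸c]] : toℕ r + n ≡ toℕ c + (toℕ r + (n ∸ toℕ c))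
      r+n≡c+[r+[n∸c]] =
        trans (cong (λ z → toℕ r + z) (sym (ℕP.m+[n∸m]≡n (ℕP.<⇒≤ (FinP.toℕ<n c)))))
          (trans (sym (ℕP.+-assoc (toℕ r) (toℕ c) _))
            (trans (cong (_+ (n ∸ toℕ c)) (ℕP.+-comm (toℕ r) (toℕ c))) (ℕP.+-assoc (toℕ c) (toℕ r) _)))

  inDiag⇒diag≡ : ∀ d (r c : Fin n) → d < n → InDiag n d r c → diag (toℕ r) (toℕ c) ≡ d
  inDiag⇒diag≡ d r c d<n (inj₁ r≡c+d) =
    trans (cong (λ z → (z + (n ∸ toℕ c)) % n) r≡c+d)
          (trans (cong (_% n) c+d+[n∸c]≡d+n) (trans ([m+n]%n≡m%n d n) (m<n⇒m%n≡m d<n)))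
    where
      c+d+[n∸c]≡d+n : toℕ c + d + (n ∸ toℕ c) ≡ d + n
      c+d+[n∸c]≡d+n = trans (cong (_+ (n ∸ toℕ c)) (ℕP.+-comm (toℕ c) d))
        (trans (ℕP.+-assoc d (toℕ c) _) (cong (λ z → d + z) (ℕP.m+[n∸m]≡n (ℕP.<⇒≤ (FinP.toℕ<n c)))))
  inDiag⇒diag≡ d r c d<n (inj₂ r+n≡c+d) = trans (cong (_% n) r+[n∸c]≡d) (m<n⇒m%n≡m d<n)
    where
      r+[n∸c]≡d : toℕ r + (n ∸ toℕ c) ≡ d
      r+[n∸c]≡d = ℕP.+-cancelʳ-≡ (toℕ c) _ _
        (trans (ℕP.+-assoc (toℕ r) _ _) (trans (cong (λ z → toℕ r + z) (ℕP.m∸n+n≡m (ℕP.<⇒≤ (FinP.toℕ<n c))))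
          (trans r+n≡c+d (ℕP.+-comm (toℕ c) d))))

  FilledDiagonal : ℕ → Set
  FilledDiagonal d = d + 2 ≤ 4 * p ⊎ d ≡ 2 * p + α

  FilledDiagonal⇔ : ∀ d → FilledDiagonal d ⇔ (d < L ⊎ d ≡ s)
  FilledDiagonal⇔ d = mk⇔
    (λ { (inj₁ d+2≤4p) → inj₁ (ℕP.≤-pred (subst₂ _≤_ (ℕP.+-comm d 2) 4p≡1+L d+2≤4p))
       ; (inj₂ d≡)     → inj₂ (trans d≡ (cong (_+ α) (sym (double≡2* p)))) })
    (λ { (inj₁ d<L) → inj₁ (subst₂ _≤_ (ℕP.+-comm 2 d) (sym 4p≡1+L) (s≤s d<L))
       ; (inj₂ d≡s) → inj₂ (trans d≡s (cong (_+ α) (double≡2* p))) })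

  filled⇔ : ∀ r c → Filled array r c ⇔ (Σ ℕ λ d → FilledDiagonal d × InDiag n d r c)
  filled⇔ r c = mk⇔ to from
    where
      d₀ = diag (toℕ r) (toℕ c)
      to : Filled array r c → Σ ℕ λ d → FilledDiagonal d × InDiag n d r c
      to (_ , eq) = d₀ , Equivalence.from (FilledDiagonal⇔ d₀) (Layout.filled⇒below-L-or-S q s d₀ (placed⇒≢none _ eq)) ,
                    inDiag-diag r c
      from : (Σ ℕ λ d → FilledDiagonal d × InDiag n d r c) → Filled array r c
      from (d , filled , inDiag) = _ , placed (classify d₀) ≢none _
        where
          d∈ = Equivalence.to (FilledDiagonal⇔ d) filled
          d<n : d < n
          d<n with d∈
          ... | inj₁ d<L = ℕP.<-trans d<L L<n
          ... | inj₂ refl = s<n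
          ≢none : classify d₀ ≢ none
          ≢none = subst (λ z → classify z ≢ none) (sym (inDiag⇒diag≡ d r c d<n inDiag)) (Layout.below-L-or-S⇒filled q s d d∈)

  heffter : IsSSHeffter n p G array
  heffter = record
    { P1-rows = RowOf.length≡4p
    ; P1-cols = ColumnOf.length≡4p
    ; P2-sub  = entries-inSupport
    ; P2-sup  = support-attained
    ; P3-rows = RowOf.sum≡0
    ; P3-cols = ColumnOf.sum≡0
    }

  globallySimple : IsGloballySimple n p G array
  globallySimple = record { rows = RowOf.simple ; cols = ColumnOf.simple }

open import Defs
open import Data.Nat using (ℕ; _+_; _*_; _∸_; _≤_; _<_)
open import Data.Nat.GCD using (gcd)
open import Data.Product using (Σ; ∃; _×_; _,_)
open import Data.Sum using (_⊎_)
open import Function.Bundles using (_⇔_)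
open import Relation.Binary.PropositionalEquality using (_≡_)

open import Data.Nat using (zero; z≤n; s≤s)
import Data.Nat.Properties as ℕP
open import Data.Product using (proj₁; proj₂)
open import Relation.Binary.PropositionalEquality using (cong; cong₂; subst; trans; sym)
import Data.Nat.Tactic.RingSolver as NS
open Doubling using (double; double≡2*)

theorem3p1 : (p n γ : ℕ) → 0 < p → 4 * p ≤ n → 0 < γ →
    (α : ℕ) → 2 * p ∸ 1 ≤ α → α + 2 * p + 1 ≤ n → gcd n α ≡ 1 →
    Σ (Array n) λ A →
    IsSSHeffter n p γ A × IsGloballySimple n p γ A ×
    (∀ r c → Filled A r c ⇔
    (Σ ℕ λ d → ((d + 2 ≤ 4 * p) ⊎ (d ≡ 2 * p + α)) × InDiag n d r c))
theorem3p1 zero    n γ ()  _    _ α _   _       _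
theorem3p1 (suc q) n γ _ 4p≤n _ α α≥2p-1 α+2p+1≤n gcd≡1 =
  array , heffter , globallySimple , filled⇔
  where
    p = suc q
    4p≤n′ : double p + double p ≤ n
    4p≤n′ = subst (_≤ n) (sym (trans (cong₂ _+_ (double≡2* p) (double≡2* p)) (lemma p))) 4p≤n
      where
        lemma : ∀ p → 2 * p + 2 * p ≡ 4 * p
        lemma = NS.solve-∀
    instance
      n≢0 : ℕ.NonZero n
      n≢0 = ℕ.>-nonZero (ℕP.<-≤-trans (s≤s z≤n) 4p≤n′)
    1<n : 1 < n
    1<n = ℕP.≤-trans (s≤s (s≤s z≤n)) 4p≤n′
    s<n : double p + α < n
    s<n = subst (_≤ n) (trans (cong (λ z → α + z + 1) (sym (double≡2* p))) (lemma α (double p))) α+2p+1≤n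
      where
        lemma : ∀ a d → a + d + 1 ≡ suc (d + a)
        lemma = NS.solve-∀
    2q<α : suc (double q) ≤ α
    2q<α = subst (_≤ α) (cong (_∸ 1) (sym (double≡2* p))) α≥2p-1
    inverse = ModularInverse.inverse-mod n 1<n α gcd≡1
    open Construction n q γ α (proj₁ inverse) 4p≤n′ s<n 2q<α (proj₂ inverse)
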